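{- Let $F$ be a field, $\Lambda=M_s(F)$, $A,B,C,D\in\Lambda$. Let $a_1,a_2,\ldots\in F$ and suppose there is a polynomial function whose value at $j$ is $a_j$ for all sufficiently large $j$. Let $R_n=\sum_{k\ge1}a_ku_k^{(n)}$. Then all matrix entries of $\sum_{n\ge0}R_nz^n$ lie in $\mathcal{L}$.
   Context: A walk of length $l\ge0$ is an $(l+1)$-tuple $\alpha=(\alpha_0,\dots,\alpha_l)$ of integers with each $\alpha_i-\alpha_{i-1}\in\{ -1,0,1\}$; it is a walk from $\alpha_0$ to $\alpha_l$. Weights: $w(\alpha)=1$ if $l=0$, else $w(\alpha)=U_1\cdots U_l$ with $U_i=A,B,C$ according as $\alpha_i-\alpha_{i-1}=-1,0,1$; $w^*(\alpha)$ is defined the same way except that $U_i=D$ whenever $\alpha_{i-1}=\alpha_i=0$. A walk is standard if $\alpha_i\ge\alpha_l$ for all $i$. For $k\ge1$, $u_k^{(n)}=\sum w^*(\alpha)$ over all standard walks of length $n$ from $k-1$ to $0$ (so $u_k^{(n)}=0$ when $k-1>n$ and $R_n$ is a finite sum). $M_0=\sum w(\alpha)z^{l(\alpha)}$ over all (not necessarily standard) walks from $0$ to $0$, $M_{ -1}$ the same sum over walks from $-1$ to $0$, $M_1$ the same sum over walks from $1$ to $0$; these are $s\times s$ matrices over $F[[z]]$. $\mathcal{L}$ is the subfield of the field of fractions of $F[[z]]$ generated over $F(z)$ by the matrix entries of $M_0,M_1,M_{ -1}$. -}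

module Defs where

open import Level using (Level; _⊔_) renaming (suc to lsuc)
open import Algebra.Bundles using (CommutativeRing)
open import Data.Nat as ℕ using (ℕ; zero; suc; _≤_; _∸_)
open import Data.Integer as ℤ using (ℤ; +_; _≤ᵇ_)
open import Data.Integer.Properties using () renaming (_≟_ to _≟ℤ_)
open import Data.Fin using (Fin)
open import Data.Fin.Base as Fin using ()
open import Data.Fin.Properties using () renaming (_≟_ to _Fin≟_)
open import Data.Bool using (Bool; true; false; if_then_else_; _∧_)
open import Data.List using (List; []; _∷_; map; foldr; concatMap; upTo)
open import Data.Product using (∃; _×_)
open import Relation.Nullary using (¬_)
open import Relation.Nullary.Decidable using (⌊_⌋)

record Field (c ℓ : Level) : Set (lsuc (c ⊔ ℓ)) where
  field
    commutativeRing : CommutativeRing c ℓ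
  open CommutativeRing commutativeRing public
  field
    1≉0 : ¬ (1# ≈ 0#)
    inverse : ∀ x → ¬ (x ≈ 0#) → ∃ λ y → (x * y) ≈ 1#

data Step : Set where
  dn st up : Step

move : ℤ → Step → ℤ
move p dn = p ℤ.- ℤ.1ℤ
move p st = p
move p up = p ℤ.+ ℤ.1ℤ

endpoint : ℤ → List Step → ℤ
endpoint p [] = p
endpoint p (x ∷ xs) = endpoint (move p x) xs

allNonNeg : ℤ → List Step → Bool
allNonNeg p [] = + 0 ≤ᵇ p
allNonNeg p (x ∷ xs) = (+ 0 ≤ᵇ p) ∧ allNonNeg (move p x) xs

isZero : ℤ → Bool
isZero p = ⌊ p ≟ℤ + 0 ⌋

-- all step sequences of length l (each walk of length l from a given start corresponds
-- to exactly one such sequence)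
allSeqs : ℕ → List (List Step)
allSeqs zero = [] ∷ []
allSeqs (suc l) = concatMap (λ xs → (dn ∷ xs) ∷ (st ∷ xs) ∷ (up ∷ xs) ∷ []) (allSeqs l)

module WithField {c ℓ : Level} (F : Field c ℓ) where
  open Field F

  Mat : ℕ → Set c
  Mat s = Fin s → Fin s → Carrier

  0M : ∀ {s} → Mat s
  0M i j = 0#

  1M : ∀ {s} → Mat s
  1M i j = if ⌊ i Fin≟ j ⌋ then 1# else 0#

  sumF : ∀ {s} → (Fin s → Carrier) → Carrier
  sumF {zero} f = 0#
  sumF {suc s} f = f Fin.zero + sumF (λ i → f (Fin.suc i))

  _+M_ : ∀ {s} → Mat s → Mat s → Mat s
  (X +M Y) i j = X i j + Y i j

  _*M_ : ∀ {s} → Mat s → Mat s → Mat s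
  (X *M Y) i j = sumF (λ k → X i k * Y k j)

  _·M_ : ∀ {s} → Carrier → Mat s → Mat s
  (x ·M X) i j = x * X i j

  sumM : ∀ {s} → List (Mat s) → Mat s
  sumM = foldr _+M_ 0M

  w : ∀ {s} → (A B C : Mat s) → ℤ → List Step → Mat s
  w A B C p [] = 1M
  w A B C p (dn ∷ xs) = A *M w A B C (move p dn) xs
  w A B C p (st ∷ xs) = B *M w A B C (move p st) xs
  w A B C p (up ∷ xs) = C *M w A B C (move p up) xs

  w* : ∀ {s} → (A B C D : Mat s) → ℤ → List Step → Mat s
  w* A B C D p [] = 1M
  w* A B C D p (dn ∷ xs) = A *M w* A B C D (move p dn) xs
  w* A B C D p (st ∷ xs) = (if isZero p then D else B) *M w* A B C D (move p st) xs
  w* A B C D p (up ∷ xs) = C *M w* A B C D (move p up) xs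

  -- coefficient of z^l in M_e : sum of w over all walks of length l from e to 0
  Mcoeff : ∀ {s} → (A B C : Mat s) → ℤ → ℕ → Mat s
  Mcoeff A B C e l =
    sumM (map (λ xs → if isZero (endpoint e xs) then w A B C e xs else 0M) (allSeqs l))

  -- u_k^{(n)} : sum of w* over standard walks of length n from k-1 to 0
  -- (a walk ending at 0 is standard iff all its positions are ≥ 0)
  u : ∀ {s} → (A B C D : Mat s) → ℕ → ℕ → Mat s
  u A B C D k n =
    sumM (map (λ xs → if isZero (endpoint (+ (k ∸ 1)) xs) ∧ allNonNeg (+ (k ∸ 1)) xs
                      then w* A B C D (+ (k ∸ 1)) xs else 0M)
              (allSeqs n))

  -- R_n = Σ_{k ≥ 1} a_k u_k^{(n)}; terms with k > n+1 vanish
  R : ∀ {s} → (A B C D : Mat s) → (ℕ → Carrier) → ℕ → Mat s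
  R A B C D a n = sumM (map (λ k → a k ·M u A B C D k n) (Data.List.map suc (upTo (suc n))))

  ι : ℕ → Carrier
  ι zero = 0#
  ι (suc n) = 1# + ι n

  evalPoly : List Carrier → Carrier → Carrier
  evalPoly [] x = 0#
  evalPoly (c ∷ cs) x = c + x * evalPoly cs x

  EventuallyPolynomial : (ℕ → Carrier) → Set (c ⊔ ℓ)
  EventuallyPolynomial a =
    ∃ λ (cs : List Carrier) → ∃ λ (N : ℕ) → ∀ j → N ≤ j → a j ≈ evalPoly cs (ι j)

  Series : Set c
  Series = ℕ → Carrier

  _≃S_ : Series → Series → Set ℓ
  f ≃S g = ∀ n → f n ≈ g n

  0S : Series
  0S n = 0#

  constS : Carrier → Series
  constS x zero = x
  constS x (suc n) = 0#

  zS : Series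
  zS zero = 0#
  zS (suc zero) = 1#
  zS (suc (suc n)) = 0#

  _+S_ : Series → Series → Series
  (f +S g) n = f n + g n

  _*S_ : Series → Series → Series
  (f *S g) n = foldr _+_ 0# (map (λ i → f i * g (n ∸ i)) (upTo (suc n)))

  data Idx : Set where
    m1 z0 p1 : Idx

  startOf : Idx → ℤ
  startOf m1 = ℤ.-1ℤ
  startOf z0 = + 0
  startOf p1 = ℤ.1ℤ

  data InRing {s : ℕ} (A B C : Mat s) : Series → Set (c ⊔ ℓ) where
    const : ∀ x → InRing A B C (constS x)
    var-z : InRing A B C zS
    entry : ∀ (e : Idx) (i j : Fin s) → InRing A B C (λ l → Mcoeff A B C (startOf e) l i j)
    add : ∀ {f g} → InRing A B C f → InRing A B C g → InRing A B C (f +S g)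
    mul : ∀ {f g} → InRing A B C f → InRing A B C g → InRing A B C (f *S g)

  -- f ∈ 𝓛 : f = p / q in Frac(F[[z]]) with p, q in the above ring, q ≠ 0.
  -- (𝓛 = F(z)(entries) is exactly the set of such quotients.)
  InL : ∀ {s} → (A B C : Mat s) → Series → Set (c ⊔ ℓ)
  InL A B C f = ∃ λ p → ∃ λ q → InRing A B C p × InRing A B C q × ¬ (q ≃S 0S) × ((f *S q) ≃S p)

-- Let F (resp. G) be the generating matrix of first passages from 1 (resp. -1) down (up) to 0. A walk
-- from e ≥ 0 to 0 passes successively through e - 1, …, 0, so M_e = Fᵉ M₀; in particular F = M₁ M₀⁻¹ lies
-- in 𝓛. Likewise u_{m+1} is the coefficient sequence of Fᵐ W with W = (1 - z (D + C F))⁻¹ ∈ 𝓛, so that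
-- Σ Rₙ zⁿ = Σₘ aₘ₊₁ Fᵐ W. Multiplying by 1 - F turns this into a₁ W plus the same sum for the difference
-- sequence; as d-fold differences of a polynomial of degree < d vanish, (1 - F)ᵈ Σ Rₙ zⁿ is a finite
-- combination of elements of 𝓛, and (1 - F)ᵈ is invertible over 𝓛 because F has no constant term.
-- The identities for M_e and u are proved by checking that the closed forms solve the first-step
-- recursions, whose series solutions are unique.

module Submission where

open import Defs
open import Level using (Level; _⊔_)
open import Algebra.Bundles using (CommutativeRing)
open import Data.Nat as ℕ using (ℕ; zero; suc; _∸_; _≤_; _<_; z≤n; s≤s)
import Data.Nat.Properties as ℕ
open import Data.Integer using (ℤ; +_; -[1+_])
open import Data.Fin as Fin using (Fin; toℕ)
open import Data.Fin.Properties using () renaming (_≟_ to _Fin≟_)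
open import Data.Bool using (Bool; true; false; if_then_else_; _∧_)
open import Data.Bool.Properties using (∧-zeroʳ)
open import Data.List using (List; []; _∷_; map; foldr; concatMap; _++_; upTo; applyUpTo; length)
open import Data.List.Properties using (map-++; map-applyUpTo)
open import Data.Product using (∃; _×_; _,_; proj₁; proj₂)
open import Function using (_∘_)
open import Relation.Nullary using (yes; no)
open import Relation.Nullary.Decidable using (⌊_⌋)
open import Relation.Binary.Bundles using (Setoid)
open import Relation.Binary.PropositionalEquality as P using (_≡_)
import Relation.Binary.Reasoning.Setoid

module SubtractionLemmas {a b : Level} (R : CommutativeRing a b) where
  open CommutativeRing R
  open import Algebra.Properties.Group +-group using (//-rightDividesʳ)
  open import Algebra.Properties.AbelianGroup +-abelianGroup using (⁻¹-∙-comm)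
  open import Algebra.Properties.CommutativeSemigroup +-commutativeSemigroup using (interchange)
  open import Algebra.Properties.CommutativeSemigroup *-commutativeSemigroup using (x∙yz≈y∙xz)
  open import Relation.Binary.Reasoning.Setoid setoid

  +≈⇒≈- : ∀ {x t v} → x + t ≈ v → x ≈ v - t
  +≈⇒≈- {x} {t} x+t≈v = trans (sym (//-rightDividesʳ t x)) (+-congʳ x+t≈v)

  +-minus-+ : ∀ p q r → (p + q) - (p + r) ≈ q - r
  +-minus-+ p q r = begin
    (p + q) + - (p + r)     ≈⟨ +-congˡ (sym (⁻¹-∙-comm p r)) ⟩
    (p + q) + (- p + - r)   ≈⟨ interchange p q (- p) (- r) ⟩
    (p - p) + (q - r)       ≈⟨ +-congʳ (-‿inverseʳ p) ⟩
    0# + (q - r)            ≈⟨ +-identityˡ _ ⟩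
    q - r                   ∎

  -- Subtracting c times the pivot row (a x + t) from a times another row (c x + u) eliminates x.
  cross-elimination : ∀ a c x u t → a * (c * x + u) - c * (a * x + t) ≈ a * u - c * t
  cross-elimination a c x u t = begin
    a * (c * x + u) - c * (a * x + t)          ≈⟨ +-cong (distribˡ a _ _) (-‿cong (distribˡ c _ _)) ⟩
    (a * (c * x) + a * u) - (c * (a * x) + c * t)
      ≈⟨ +-congʳ (+-congʳ (x∙yz≈y∙xz a c x)) ⟩
    (c * (a * x) + a * u) - (c * (a * x) + c * t) ≈⟨ +-minus-+ _ _ _ ⟩
    a * u - c * t                              ∎

module Matrices {a b : Level} (R : CommutativeRing a b) where
  open CommutativeRing R
  open import Algebra.Properties.Semiring.Sum semiring public
    using (sum; sum-cong-≋; ∑-distrib-+; ∑-comm; *-distribˡ-sum; *-distribʳ-sum; sum-replicate-zero)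
  open import Algebra.Properties.Ring ring using (-‿distribʳ-*; -‿distribˡ-*; -‿+-comm; -0#≈0#)
  open import Algebra.Properties.CommutativeSemigroup *-commutativeSemigroup using (x∙yz≈y∙xz)

  sum-zero : ∀ {s} (f : Fin s → Carrier) → (∀ k → f k ≈ 0#) → sum f ≈ 0#
  sum-zero {s} f f≈0 = trans (sum-cong-≋ f≈0) (sum-replicate-zero s)

  sum-neg : ∀ {s} (f : Fin s → Carrier) → sum (λ k → - f k) ≈ - sum f
  sum-neg {zero} f = sym -0#≈0#
  sum-neg {suc s} f = trans (+-congˡ (sum-neg (λ k → f (Fin.suc k)))) (-‿+-comm _ _)

  sum-combination : ∀ {t} x y (f g h : Fin t → Carrier) →
    sum (λ k → (x * f k - y * g k) * h k) ≈ x * sum (λ k → f k * h k) - y * sum (λ k → g k * h k)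
  sum-combination {t} x y f g h = begin
    sum (λ k → (x * f k - y * g k) * h k)
      ≈⟨ sum-cong-≋ {t} (λ k → trans (distribʳ _ _ _)
           (+-cong (*-assoc x (f k) (h k)) (trans (sym (-‿distribˡ-* _ _)) (-‿cong (*-assoc y (g k) (h k)))))) ⟩
    sum (λ k → x * (f k * h k) - y * (g k * h k))
      ≈⟨ ∑-distrib-+ (λ k → x * (f k * h k)) (λ k → - (y * (g k * h k))) ⟩
    sum (λ k → x * (f k * h k)) + sum (λ k → - (y * (g k * h k)))
      ≈⟨ +-cong (sym (*-distribˡ-sum x (λ k → f k * h k)))
                (trans (sum-neg (λ k → y * (g k * h k))) (-‿cong (sym (*-distribˡ-sum y (λ k → g k * h k))))) ⟩
    x * sum (λ k → f k * h k) - y * sum (λ k → g k * h k) ∎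
    where open import Relation.Binary.Reasoning.Setoid setoid

  δ : ∀ {s} → Fin s → Fin s → Carrier
  δ i j = if ⌊ i Fin≟ j ⌋ then 1# else 0#

  δ-suc : ∀ {s} (i j : Fin s) → δ (Fin.suc i) (Fin.suc j) ≡ δ i j
  δ-suc i j with i Fin≟ j
  ... | yes _ = P.refl
  ... | no _ = P.refl

  δ-sym : ∀ {s} (i j : Fin s) → δ i j ≡ δ j i
  δ-sym Fin.zero Fin.zero = P.refl
  δ-sym Fin.zero (Fin.suc j) = P.refl
  δ-sym (Fin.suc i) Fin.zero = P.refl
  δ-sym (Fin.suc i) (Fin.suc j) = P.trans (δ-suc i j) (P.trans (δ-sym i j) (P.sym (δ-suc j i)))

  sum-δˡ : ∀ {s} (i : Fin s) (f : Fin s → Carrier) → sum (λ k → δ i k * f k) ≈ f i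
  sum-δˡ {suc s} Fin.zero f =
    trans (+-cong (*-identityˡ _) (sum-zero (λ k → 0# * f (Fin.suc k)) (λ k → zeroˡ _))) (+-identityʳ _)
  sum-δˡ {suc s} (Fin.suc i) f =
    trans (+-cong (zeroˡ _) (sum-cong-≋ (λ k → *-congʳ (reflexive (δ-suc i k)))))
          (trans (+-identityˡ _) (sum-δˡ i (λ k → f (Fin.suc k))))

  Mx : ℕ → Set a
  Mx s = Fin s → Fin s → Carrier

  module _ {s : ℕ} where
    infix 4 _≋_
    infixl 6 _⊞_ _⊟_
    infixl 7 _⊠_ _⊙_

    _≋_ : Mx s → Mx s → Set b
    X ≋ Y = ∀ i j → X i j ≈ Y i j

    _⊞_ _⊟_ _⊠_ : Mx s → Mx s → Mx s
    (X ⊞ Y) i j = X i j + Y i j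
    (X ⊟ Y) i j = X i j - Y i j
    (X ⊠ Y) i j = sum (λ k → X i k * Y k j)

    _⊙_ : Carrier → Mx s → Mx s
    (x ⊙ Y) i j = x * Y i j

    𝟙 𝟘 : Mx s
    𝟙 = δ
    𝟘 i j = 0#

    ≋-setoid : Setoid a b
    ≋-setoid = record
      { Carrier = Mx s ; _≈_ = _≋_
      ; isEquivalence = record
        { refl = λ i j → refl ; sym = λ p i j → sym (p i j) ; trans = λ p q i j → trans (p i j) (q i j) } }

    open Setoid ≋-setoid public using ()
      renaming (refl to ≋-refl; sym to ≋-sym; trans to ≋-trans)

    ⊞-cong : ∀ {X X′ Y Y′} → X ≋ X′ → Y ≋ Y′ → X ⊞ Y ≋ X′ ⊞ Y′
    ⊞-cong p q i j = +-cong (p i j) (q i j)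

    ⊟-cong : ∀ {X X′ Y Y′} → X ≋ X′ → Y ≋ Y′ → X ⊟ Y ≋ X′ ⊟ Y′
    ⊟-cong p q i j = +-cong (p i j) (-‿cong (q i j))

    ⊠-cong : ∀ {X X′ Y Y′} → X ≋ X′ → Y ≋ Y′ → X ⊠ Y ≋ X′ ⊠ Y′
    ⊠-cong p q i j = sum-cong-≋ {s} (λ k → *-cong (p i k) (q k j))

    ⊙-congˡ : ∀ x {Y Y′} → Y ≋ Y′ → x ⊙ Y ≋ x ⊙ Y′
    ⊙-congˡ x q i j = *-congˡ (q i j)

    ⊞-identityˡ : ∀ X → 𝟘 ⊞ X ≋ X
    ⊞-identityˡ X i j = +-identityˡ _

    ⊞-reverse : ∀ X Y Z → X ⊞ Y ⊞ Z ≋ Z ⊞ Y ⊞ X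
    ⊞-reverse X Y Z i j = trans (+-comm _ _) (trans (+-congˡ (+-comm _ _)) (sym (+-assoc _ _ _)))

    ⊠-assoc : ∀ X Y Z → (X ⊠ Y) ⊠ Z ≋ X ⊠ (Y ⊠ Z)
    ⊠-assoc X Y Z i j = begin
      sum (λ k → sum (λ l → X i l * Y l k) * Z k j)
        ≈⟨ sum-cong-≋ {s} (λ k → *-distribʳ-sum (Z k j) (λ l → X i l * Y l k)) ⟩
      sum (λ k → sum (λ l → X i l * Y l k * Z k j))
        ≈⟨ ∑-comm (λ k l → X i l * Y l k * Z k j) ⟩
      sum (λ l → sum (λ k → X i l * Y l k * Z k j))
        ≈⟨ sum-cong-≋ {s} (λ l → sum-cong-≋ {s} (λ k → *-assoc _ _ _)) ⟩
      sum (λ l → sum (λ k → X i l * (Y l k * Z k j)))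
        ≈⟨ sum-cong-≋ {s} (λ l → sym (*-distribˡ-sum (X i l) (λ k → Y l k * Z k j))) ⟩
      sum (λ l → X i l * sum (λ k → Y l k * Z k j)) ∎
      where open import Relation.Binary.Reasoning.Setoid setoid

    ⊠-distribˡ : ∀ X Y Z → X ⊠ (Y ⊞ Z) ≋ X ⊠ Y ⊞ X ⊠ Z
    ⊠-distribˡ X Y Z i j =
      trans (sum-cong-≋ {s} (λ k → distribˡ _ _ _)) (∑-distrib-+ (λ k → X i k * Y k j) (λ k → X i k * Z k j))

    ⊠-distribʳ : ∀ X Y Z → (Y ⊞ Z) ⊠ X ≋ Y ⊠ X ⊞ Z ⊠ X
    ⊠-distribʳ X Y Z i j =
      trans (sum-cong-≋ {s} (λ k → distribʳ _ _ _)) (∑-distrib-+ (λ k → Y i k * X k j) (λ k → Z i k * X k j))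

    ⊟-distribˡ : ∀ X Y Z → X ⊠ (Y ⊟ Z) ≋ X ⊠ Y ⊟ X ⊠ Z
    ⊟-distribˡ X Y Z i j =
      trans (sum-cong-≋ {s} (λ k → trans (distribˡ _ _ _) (+-congˡ (sym (-‿distribʳ-* _ _)))))
            (trans (∑-distrib-+ (λ k → X i k * Y k j) (λ k → - (X i k * Z k j)))
                   (+-congˡ (sum-neg (λ k → X i k * Z k j))))

    ⊟-distribʳ : ∀ X Y Z → (Y ⊟ Z) ⊠ X ≋ Y ⊠ X ⊟ Z ⊠ X
    ⊟-distribʳ X Y Z i j =
      trans (sum-cong-≋ {s} (λ k → trans (distribʳ _ _ _) (+-congˡ (sym (-‿distribˡ-* _ _)))))
            (trans (∑-distrib-+ (λ k → Y i k * X k j) (λ k → - (Z i k * X k j)))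
                   (+-congˡ (sum-neg (λ k → Z i k * X k j))))

    ⊠-identityˡ : ∀ X → 𝟙 ⊠ X ≋ X
    ⊠-identityˡ X i j = sum-δˡ i (λ k → X k j)

    ⊠-zeroˡ : ∀ X → 𝟘 ⊠ X ≋ 𝟘
    ⊠-zeroˡ X i j = sum-zero (λ k → 0# * X k j) (λ k → zeroˡ _)

    ⊠-zeroʳ : ∀ X → X ⊠ 𝟘 ≋ 𝟘
    ⊠-zeroʳ X i j = sum-zero (λ k → X i k * 0#) (λ k → zeroʳ _)

    ⊙-⊠ˡ : ∀ x X Y → (x ⊙ X) ⊠ Y ≋ x ⊙ (X ⊠ Y)
    ⊙-⊠ˡ x X Y i j = trans (sum-cong-≋ {s} (λ k → *-assoc _ _ _)) (sym (*-distribˡ-sum x (λ k → X i k * Y k j)))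

    ⊙-⊠ʳ : ∀ x X Y → X ⊠ (x ⊙ Y) ≋ x ⊙ (X ⊠ Y)
    ⊙-⊠ʳ x X Y i j =
      trans (sum-cong-≋ {s} (λ k → x∙yz≈y∙xz (X i k) x (Y k j)))
            (sym (*-distribˡ-sum x (λ k → X i k * Y k j)))

    ⊠-quadratic : ∀ z a b c X → X ≋ z ⊙ (a ⊞ b ⊠ X ⊞ c ⊠ X ⊠ X) →
      ∀ Y → X ⊠ Y ≋ z ⊙ (a ⊠ Y ⊞ b ⊠ (X ⊠ Y) ⊞ c ⊠ (X ⊠ (X ⊠ Y)))
    ⊠-quadratic z a b c X X-eq Y = begin
      X ⊠ Y                                ≈⟨ ⊠-cong X-eq ≋-refl ⟩
      z ⊙ (a ⊞ b ⊠ X ⊞ c ⊠ X ⊠ X) ⊠ Y     ≈⟨ ⊙-⊠ˡ z _ Y ⟩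
      z ⊙ ((a ⊞ b ⊠ X ⊞ c ⊠ X ⊠ X) ⊠ Y)
        ≈⟨ ⊙-congˡ z (≋-trans (⊠-distribʳ Y _ _) (⊞-cong (⊠-distribʳ Y _ _) ≋-refl)) ⟩
      z ⊙ (a ⊠ Y ⊞ b ⊠ X ⊠ Y ⊞ c ⊠ X ⊠ X ⊠ Y)
        ≈⟨ ⊙-congˡ z (⊞-cong (⊞-cong ≋-refl (⊠-assoc b X Y))
                            (≋-trans (⊠-assoc (c ⊠ X) X Y) (⊠-assoc c X (X ⊠ Y)))) ⟩
      z ⊙ (a ⊠ Y ⊞ b ⊠ (X ⊠ Y) ⊞ c ⊠ (X ⊠ (X ⊠ Y))) ∎
      where open import Relation.Binary.Reasoning.Setoid ≋-setoid

    _ᵀ : Mx s → Mx s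
    (X ᵀ) i j = X j i

    ⊠-transpose : ∀ X Y → (X ⊠ Y) ᵀ ≋ Y ᵀ ⊠ X ᵀ
    ⊠-transpose X Y i j = sum-cong-≋ {s} (λ k → *-comm (X j k) (Y k i))

    infixr 8 _^[_]_
    _^[_]_ : Mx s → ℕ → Mx s → Mx s
    X ^[ zero ] Y = Y
    X ^[ suc n ] Y = X ⊠ (X ^[ n ] Y)

    ^[]-cong : ∀ X n {Y Y′} → Y ≋ Y′ → X ^[ n ] Y ≋ X ^[ n ] Y′
    ^[]-cong X zero Y≋Y′ = Y≋Y′
    ^[]-cong X (suc n) Y≋Y′ = ⊠-cong ≋-refl (^[]-cong X n Y≋Y′)

    ^[]-distrib : ∀ X n Y Z → X ^[ n ] (Y ⊞ Z) ≋ X ^[ n ] Y ⊞ X ^[ n ] Z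
    ^[]-distrib X zero Y Z = ≋-refl
    ^[]-distrib X (suc n) Y Z = ≋-trans (⊠-cong ≋-refl (^[]-distrib X n Y Z)) (⊠-distribˡ X _ _)

    ^[]-⊠-assoc : ∀ X n Y Z → (X ^[ n ] Y) ⊠ Z ≋ X ^[ n ] (Y ⊠ Z)
    ^[]-⊠-assoc X zero Y Z = ≋-refl
    ^[]-⊠-assoc X (suc n) Y Z = ≋-trans (⊠-assoc X _ Z) (⊠-cong ≋-refl (^[]-⊠-assoc X n Y Z))

    ^[]-commute : ∀ X Z → (∀ Y → X ⊠ (Z ⊠ Y) ≋ Z ⊠ (X ⊠ Y)) →
      ∀ n Y → Z ⊠ (X ^[ n ] Y) ≋ X ^[ n ] (Z ⊠ Y)
    ^[]-commute X Z XZ≋ZX zero Y = ≋-refl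
    ^[]-commute X Z XZ≋ZX (suc n) Y =
      ≋-trans (≋-sym (XZ≋ZX (X ^[ n ] Y))) (⊠-cong ≋-refl (^[]-commute X Z XZ≋ZX n Y))

module PowerSeries {c ℓ : Level} (𝔽 : Field c ℓ) where
  open Field 𝔽 hiding (zero)
  open WithField 𝔽 using (Series; _≃S_; 0S; constS; zS; _+S_; _*S_)
  open import Algebra.Properties.CommutativeSemigroup +-commutativeSemigroup using (interchange; x∙yz≈y∙xz)
  open import Relation.Binary.Reasoning.Setoid setoid

  shift : Series → Series
  shift f n = f (suc n)

  infixl 7 _⊛_
  _⊛_ : Series → Series → Series
  (f ⊛ g) zero = f 0 * g 0
  (f ⊛ g) (suc n) = f 0 * g (suc n) + (shift f ⊛ g) n

  *S≈⊛ : ∀ f g n → (f *S g) n ≈ (f ⊛ g) n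
  *S≈⊛ f g zero = +-identityʳ _
  *S≈⊛ f g (suc n) = +-congˡ (trans (reflexive (P.cong (foldr _+_ 0#) reindex)) (*S≈⊛ (shift f) g n))
    where
    reindex : map (λ i → f i * g (suc n ∸ i)) (applyUpTo suc (suc n))
            ≡ map (λ i → f (suc i) * g (n ∸ i)) (upTo (suc n))
    reindex = P.trans (map-applyUpTo suc (λ i → f i * g (suc n ∸ i)) (suc n))
                      (P.sym (map-applyUpTo (λ i → i) (λ i → f (suc i) * g (n ∸ i)) (suc n)))

  ⊛-cong : ∀ {f f′ g g′} → f ≃S f′ → g ≃S g′ → (f ⊛ g) ≃S (f′ ⊛ g′)
  ⊛-cong f≃ g≃ zero = *-cong (f≃ 0) (g≃ 0)
  ⊛-cong f≃ g≃ (suc n) = +-cong (*-cong (f≃ 0) (g≃ (suc n))) (⊛-cong (f≃ ∘ suc) g≃ n)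

  ⊛-distribʳ : ∀ h f g → ((f +S g) ⊛ h) ≃S ((f ⊛ h) +S (g ⊛ h))
  ⊛-distribʳ h f g zero = distribʳ _ _ _
  ⊛-distribʳ h f g (suc n) = begin
    (f 0 + g 0) * h (suc n) + ((shift f +S shift g) ⊛ h) n
      ≈⟨ +-cong (distribʳ _ _ _) (⊛-distribʳ h (shift f) (shift g) n) ⟩
    (f 0 * h (suc n) + g 0 * h (suc n)) + ((shift f ⊛ h) n + (shift g ⊛ h) n)
      ≈⟨ interchange _ _ _ _ ⟩
    (f ⊛ h) (suc n) + (g ⊛ h) (suc n) ∎

  ⊛-scaleˡ : ∀ x f g n → ((λ m → x * f m) ⊛ g) n ≈ x * (f ⊛ g) n
  ⊛-scaleˡ x f g zero = *-assoc _ _ _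
  ⊛-scaleˡ x f g (suc n) =
    trans (+-cong (*-assoc _ _ _) (⊛-scaleˡ x (shift f) g n)) (sym (distribˡ _ _ _))

  ⊛-zeroˡ : ∀ g → (0S ⊛ g) ≃S 0S
  ⊛-zeroˡ g zero = zeroˡ _
  ⊛-zeroˡ g (suc n) = trans (+-cong (zeroˡ _) (⊛-zeroˡ g n)) (+-identityʳ _)

  ⊛-constˡ : ∀ x g n → (constS x ⊛ g) n ≈ x * g n
  ⊛-constˡ x g zero = refl
  ⊛-constˡ x g (suc n) = trans (+-congˡ (⊛-zeroˡ g n)) (+-identityʳ _)

  -- Peeling the constant terms off both factors exposes (shift f ⊛ shift g) on each side.
  ⊛-comm : ∀ f g → (f ⊛ g) ≃S (g ⊛ f)
  ⊛-comm f g zero = *-comm _ _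
  ⊛-comm f g (suc zero) = trans (+-comm _ _) (+-cong (*-comm _ _) (*-comm _ _))
  ⊛-comm f g (suc (suc n)) = begin
    f 0 * g (suc (suc n)) + (shift f ⊛ g) (suc n)
      ≈⟨ +-congˡ (⊛-comm (shift f) g (suc n)) ⟩
    f 0 * g (suc (suc n)) + (g 0 * f (suc (suc n)) + (shift g ⊛ shift f) n)
      ≈⟨ +-congˡ (+-congˡ (⊛-comm (shift g) (shift f) n)) ⟩
    f 0 * g (suc (suc n)) + (g 0 * f (suc (suc n)) + (shift f ⊛ shift g) n)
      ≈⟨ x∙yz≈y∙xz _ _ _ ⟩
    g 0 * f (suc (suc n)) + (f 0 * g (suc (suc n)) + (shift f ⊛ shift g) n)
      ≈⟨ +-congˡ (⊛-comm f (shift g) (suc n)) ⟩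
    g 0 * f (suc (suc n)) + (shift g ⊛ f) (suc n) ∎

  ⊛-assoc : ∀ f g h → ((f ⊛ g) ⊛ h) ≃S (f ⊛ (g ⊛ h))
  ⊛-assoc f g h zero = *-assoc _ _ _
  ⊛-assoc f g h (suc n) = begin
    (f 0 * g 0) * h (suc n) + (shift (f ⊛ g) ⊛ h) n
      ≈⟨ +-congˡ (⊛-distribʳ h (λ m → f 0 * shift g m) (shift f ⊛ g) n) ⟩
    (f 0 * g 0) * h (suc n) + (((λ m → f 0 * shift g m) ⊛ h) n + ((shift f ⊛ g) ⊛ h) n)
      ≈⟨ +-congˡ (+-cong (⊛-scaleˡ (f 0) (shift g) h n) (⊛-assoc (shift f) g h n)) ⟩
    (f 0 * g 0) * h (suc n) + (f 0 * (shift g ⊛ h) n + (shift f ⊛ (g ⊛ h)) n)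
      ≈⟨ sym (+-assoc _ _ _) ⟩
    ((f 0 * g 0) * h (suc n) + f 0 * (shift g ⊛ h) n) + (shift f ⊛ (g ⊛ h)) n
      ≈⟨ +-congʳ (trans (+-congʳ (*-assoc _ _ _)) (sym (distribˡ _ _ _))) ⟩
    f 0 * (g 0 * h (suc n) + (shift g ⊛ h) n) + (shift f ⊛ (g ⊛ h)) n ∎

  -S_ : Series → Series
  (-S f) n = - f n

  1S : Series
  1S = constS 1#

  *S-cong : ∀ {f f′ g g′} → f ≃S f′ → g ≃S g′ → (f *S g) ≃S (f′ *S g′)
  *S-cong {f} {f′} {g} {g′} f≃ g≃ n =
    trans (*S≈⊛ f g n) (trans (⊛-cong f≃ g≃ n) (sym (*S≈⊛ f′ g′ n)))

  *S-comm : ∀ f g → (f *S g) ≃S (g *S f)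
  *S-comm f g n = trans (*S≈⊛ f g n) (trans (⊛-comm f g n) (sym (*S≈⊛ g f n)))

  *S-assoc : ∀ f g h → ((f *S g) *S h) ≃S (f *S (g *S h))
  *S-assoc f g h n = begin
    ((f *S g) *S h) n ≈⟨ *S≈⊛ (f *S g) h n ⟩
    ((f *S g) ⊛ h) n  ≈⟨ ⊛-cong (*S≈⊛ f g) (λ _ → refl) n ⟩
    ((f ⊛ g) ⊛ h) n   ≈⟨ ⊛-assoc f g h n ⟩
    (f ⊛ (g ⊛ h)) n   ≈⟨ ⊛-cong (λ _ → refl) (λ m → sym (*S≈⊛ g h m)) n ⟩
    (f ⊛ (g *S h)) n  ≈⟨ sym (*S≈⊛ f (g *S h) n) ⟩
    (f *S (g *S h)) n ∎

  *S-distribʳ : ∀ h f g → ((f +S g) *S h) ≃S ((f *S h) +S (g *S h))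
  *S-distribʳ h f g n = trans (*S≈⊛ (f +S g) h n)
    (trans (⊛-distribʳ h f g n) (sym (+-cong (*S≈⊛ f h n) (*S≈⊛ g h n))))

  *S-constˡ : ∀ x g n → (constS x *S g) n ≈ x * g n
  *S-constˡ x g n = trans (*S≈⊛ (constS x) g n) (⊛-constˡ x g n)

  *S-identityˡ : ∀ g → (1S *S g) ≃S g
  *S-identityˡ g n = trans (*S-constˡ 1# g n) (*-identityˡ _)

  seriesRing : CommutativeRing c ℓ
  seriesRing = record
    { Carrier = Series ; _≈_ = _≃S_ ; _+_ = _+S_ ; _*_ = _*S_ ; -_ = -S_ ; 0# = 0S ; 1# = 1S
    ; isCommutativeRing = record
      { isRing = record
        { +-isAbelianGroup = record
          { isGroup = record
            { isMonoid = record
              { isSemigroup = record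
                { isMagma = record
                  { isEquivalence = record
                    { refl = λ n → refl ; sym = λ p n → sym (p n) ; trans = λ p q n → trans (p n) (q n) }
                  ; ∙-cong = λ p q n → +-cong (p n) (q n) }
                ; assoc = λ f g h n → +-assoc _ _ _ }
              ; identity = (λ f n → +-identityˡ _) , (λ f n → +-identityʳ _) }
            ; inverse = (λ f n → -‿inverseˡ _) , (λ f n → -‿inverseʳ _)
            ; ⁻¹-cong = λ p n → -‿cong (p n) }
          ; comm = λ f g n → +-comm _ _ }
        ; *-cong = *S-cong
        ; *-assoc = *S-assoc
        ; *-identity = *S-identityˡ , (λ g n → trans (*S-comm g 1S n) (*S-identityˡ g n))
        ; distrib = (λ h f g n → trans (*S-comm h (f +S g) n) (trans (*S-distribʳ h f g n)
                                   (+-cong (*S-comm f h n) (*S-comm g h n))))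
                  , *S-distribʳ }
      ; *-comm = *S-comm } }

  sum-coeff : ∀ {t} (f : Fin t → Series) n →
    Matrices.sum seriesRing f n ≈ Matrices.sum commutativeRing (λ k → f k n)
  sum-coeff {zero} f n = refl
  sum-coeff {suc t} f n = +-congˡ (sum-coeff (f ∘ Fin.suc) n)

  *S-at-zero : ∀ f g → (f *S g) 0 ≈ f 0 * g 0
  *S-at-zero f g = *S≈⊛ f g 0

  zS-*S-zero : ∀ g → (zS *S g) 0 ≈ 0#
  zS-*S-zero g = trans (*S-at-zero zS g) (zeroˡ _)

  zS-*S-suc : ∀ g n → (zS *S g) (suc n) ≈ g n
  zS-*S-suc g n = trans (*S≈⊛ zS g (suc n))
    (trans (+-cong (zeroˡ _) (⊛-cong {shift zS} {constS 1#} (λ { zero → refl ; (suc _) → refl }) (λ _ → refl) n))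
    (trans (+-identityˡ _) (trans (⊛-constˡ 1# g n) (*-identityˡ _))))

  AgreeBelow : ℕ → Series → Series → Set ℓ
  AgreeBelow n f g = ∀ m → m < n → f m ≈ g m

  ⊛-agree : ∀ m f f′ g g′ → AgreeBelow (suc m) f f′ → AgreeBelow (suc m) g g′ →
    (f ⊛ g) m ≈ (f′ ⊛ g′) m
  ⊛-agree zero f f′ g g′ f≈ g≈ = *-cong (f≈ 0 (s≤s z≤n)) (g≈ 0 (s≤s z≤n))
  ⊛-agree (suc m) f f′ g g′ f≈ g≈ = +-cong (*-cong (f≈ 0 (s≤s z≤n)) (g≈ (suc m) ℕ.≤-refl))
    (⊛-agree m (shift f) (shift f′) g g′ (λ k k<m → f≈ (suc k) (s≤s k<m))
                                         (λ k k<m → g≈ k (ℕ.m≤n⇒m≤1+n k<m)))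

  *S-agree : ∀ n {f f′ g g′} → AgreeBelow n f f′ → AgreeBelow n g g′ → AgreeBelow n (f *S g) (f′ *S g′)
  *S-agree n {f} {f′} {g} {g′} f≈ g≈ m m<n = trans (*S≈⊛ f g m) (trans
    (⊛-agree m f f′ g g′ (λ k k≤m → f≈ k (ℕ.<-≤-trans k≤m m<n))
                         (λ k k≤m → g≈ k (ℕ.<-≤-trans k≤m m<n)))
    (sym (*S≈⊛ f′ g′ m)))

  VanishesBelow : ℕ → Series → Set ℓ
  VanishesBelow n f = ∀ m → m < n → f m ≈ 0#

  ⊛-vanishes : ∀ p q f g → VanishesBelow p f → VanishesBelow q g → VanishesBelow (p ℕ.+ q) (f ⊛ g)
  ⊛-vanishes zero q f g _ g≈0 zero 0<q = trans (*-congˡ (g≈0 0 0<q)) (zeroʳ _)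
  ⊛-vanishes (suc p) q f g f≈0 _ zero _ = trans (*-congʳ (f≈0 0 (s≤s z≤n))) (zeroˡ _)
  ⊛-vanishes zero q f g _ g≈0 (suc m) m<q = trans (+-cong (trans (*-congˡ (g≈0 (suc m) m<q)) (zeroʳ _))
    (⊛-vanishes zero q (shift f) g (λ _ ()) g≈0 m (ℕ.<-trans (ℕ.n<1+n m) m<q))) (+-identityʳ _)
  ⊛-vanishes (suc p) q f g f≈0 g≈0 (suc m) (s≤s m<) = trans (+-cong (trans (*-congʳ (f≈0 0 (s≤s z≤n))) (zeroˡ _))
    (⊛-vanishes p q (shift f) g (λ k k<p → f≈0 (suc k) (s≤s k<p)) g≈0 m m<)) (+-identityʳ _)

  *S-vanishes : ∀ p q f g → VanishesBelow p f → VanishesBelow q g → VanishesBelow (p ℕ.+ q) (f *S g)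
  *S-vanishes p q f g f≈0 g≈0 m m< = trans (*S≈⊛ f g m) (⊛-vanishes p q f g f≈0 g≈0 m m<)

module Walks {c ℓ : Level} (𝔽 : Field c ℓ) {s : ℕ} where
  open Field 𝔽 hiding (zero)
  open WithField 𝔽
  open Matrices commutativeRing
  open import Relation.Binary.Reasoning.Setoid (≋-setoid {s})

  sumF≡sum : ∀ {t} (f : Fin t → Carrier) → sumF f ≡ sum f
  sumF≡sum {zero} f = P.refl
  sumF≡sum {suc t} f = P.cong (λ x → f Fin.zero + x) (sumF≡sum (f ∘ Fin.suc))

  *M≋⊠ : ∀ (X Y : Mat s) → X *M Y ≋ X ⊠ Y
  *M≋⊠ X Y i j = reflexive (sumF≡sum (λ k → X i k * Y k j))

  sumM-++ : ∀ (Xs Ys : List (Mat s)) → sumM (Xs ++ Ys) ≋ sumM Xs ⊞ sumM Ys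
  sumM-++ [] Ys i j = sym (+-identityˡ _)
  sumM-++ (X ∷ Xs) Ys i j = trans (+-congˡ (sumM-++ Xs Ys i j)) (sym (+-assoc _ _ _))

  sumM-map-⊞ : ∀ {A : Set} (f g : A → Mat s) (as : List A) →
    sumM (map (λ x → f x ⊞ g x) as) ≋ sumM (map f as) ⊞ sumM (map g as)
  sumM-map-⊞ f g [] i j = sym (+-identityˡ _)
  sumM-map-⊞ f g (x ∷ as) i j = trans (+-congˡ (sumM-map-⊞ f g as i j)) (interchange _ _ _ _)
    where open import Algebra.Properties.CommutativeSemigroup +-commutativeSemigroup using (interchange)

  sumM-map-⊠ : ∀ {A : Set} (K : Mat s) (f : A → Mat s) (as : List A) →
    sumM (map (λ x → K ⊠ f x) as) ≋ K ⊠ sumM (map f as)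
  sumM-map-⊠ K f [] = ≋-sym (⊠-zeroʳ K)
  sumM-map-⊠ K f (x ∷ as) = ≋-trans (⊞-cong ≋-refl (sumM-map-⊠ K f as)) (≋-sym (⊠-distribˡ K (f x) _))

  sumM-map-cong : ∀ {A : Set} {f g : A → Mat s} (as : List A) → (∀ x → f x ≋ g x) →
    sumM (map f as) ≋ sumM (map g as)
  sumM-map-cong [] f≋g = ≋-refl
  sumM-map-cong (x ∷ as) f≋g = ⊞-cong (f≋g x) (sumM-map-cong as f≋g)

  sumM-map-concatMap : ∀ {A : Set} (f : A → Mat s) (g : A → List A) (as : List A) →
    sumM (map f (concatMap g as)) ≋ sumM (map (λ x → sumM (map f (g x))) as)
  sumM-map-concatMap f g [] = ≋-refl
  sumM-map-concatMap f g (x ∷ as) = begin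
    sumM (map f (g x ++ concatMap g as))       ≡⟨ P.cong sumM (map-++ f (g x) (concatMap g as)) ⟩
    sumM (map f (g x) ++ map f (concatMap g as)) ≈⟨ sumM-++ (map f (g x)) _ ⟩
    sumM (map f (g x)) ⊞ sumM (map f (concatMap g as)) ≈⟨ ⊞-cong ≋-refl (sumM-map-concatMap f g as) ⟩
    sumM (map (λ x → sumM (map f (g x))) (x ∷ as)) ∎

  guardedSum : (List Step → Bool) → (List Step → Mat s) → ℕ → Mat s
  guardedSum g W l = sumM (map (λ xs → if g xs then W xs else 0M) (allSeqs l))

  guardedSum-suc : ∀ g W l → guardedSum g W (suc l) ≋
    guardedSum (g ∘ (dn ∷_)) (W ∘ (dn ∷_)) l ⊞ guardedSum (g ∘ (st ∷_)) (W ∘ (st ∷_)) l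
      ⊞ guardedSum (g ∘ (up ∷_)) (W ∘ (up ∷_)) l
  guardedSum-suc g W l = begin
    sumM (map φ (concatMap (λ xs → (dn ∷ xs) ∷ (st ∷ xs) ∷ (up ∷ xs) ∷ []) (allSeqs l)))
      ≈⟨ sumM-map-concatMap φ _ (allSeqs l) ⟩
    sumM (map (λ xs → φ (dn ∷ xs) ⊞ (φ (st ∷ xs) ⊞ (φ (up ∷ xs) ⊞ 0M))) (allSeqs l))
      ≈⟨ sumM-map-cong (allSeqs l) (λ xs i j → trans (+-congˡ (+-congˡ (+-identityʳ _))) (sym (+-assoc _ _ _))) ⟩
    sumM (map (λ xs → φ (dn ∷ xs) ⊞ φ (st ∷ xs) ⊞ φ (up ∷ xs)) (allSeqs l))
      ≈⟨ ≋-trans (sumM-map-⊞ _ _ (allSeqs l)) (⊞-cong (sumM-map-⊞ _ _ (allSeqs l)) ≋-refl) ⟩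
    _ ∎
    where
    φ : List Step → Mat s
    φ xs = if g xs then W xs else 0M

  guardedSum-⊠ : ∀ g W (K : Mat s) l → guardedSum g (λ xs → K *M W xs) l ≋ K ⊠ guardedSum g W l
  guardedSum-⊠ g W K l = ≋-trans (sumM-map-cong (allSeqs l) guarded) (sumM-map-⊠ K _ (allSeqs l))
    where
    guarded : ∀ xs → (if g xs then K *M W xs else 0M) ≋ K ⊠ (if g xs then W xs else 0M)
    guarded xs with g xs
    ... | true = *M≋⊠ K (W xs)
    ... | false = ≋-sym (⊠-zeroʳ K)

  guardedSum-false : ∀ g W l → (∀ xs → g xs ≡ false) → guardedSum g W l ≋ 𝟘
  guardedSum-false g W l g≡false = ≋-trans (sumM-map-cong (allSeqs l) zero-term) (zeros (allSeqs l))
    where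
    zero-term : ∀ xs → (if g xs then W xs else 0M) ≋ 0M
    zero-term xs rewrite g≡false xs = ≋-refl
    zeros : ∀ (xss : List (List Step)) → sumM (map (λ _ → 0M) xss) ≋ 𝟘
    zeros [] = ≋-refl
    zeros (_ ∷ xss) = ≋-trans (⊞-identityˡ _) (zeros xss)

  endsAtZero : ℤ → List Step → Bool
  endsAtZero p xs = isZero (endpoint p xs)

  isStandard : ℤ → List Step → Bool
  isStandard p xs = isZero (endpoint p xs) ∧ allNonNeg p xs

  module _ (A B C D : Mat s) where

    Mcoeff-zero : ∀ e → Mcoeff A B C e 0 ≋ (if isZero e then 1M else 0M)
    Mcoeff-zero e i j = +-identityʳ _

    Mcoeff-suc : ∀ e l → Mcoeff A B C e (suc l) ≋
      A ⊠ Mcoeff A B C (move e dn) l ⊞ B ⊠ Mcoeff A B C e l ⊞ C ⊠ Mcoeff A B C (move e up) l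
    Mcoeff-suc e l = ≋-trans (guardedSum-suc (endsAtZero e) (w A B C e) l)
      (⊞-cong (⊞-cong (by-step dn A) (by-step st B)) (by-step up C))
      where
      by-step : ∀ x K → guardedSum (endsAtZero (move e x)) (λ xs → K *M w A B C (move e x) xs) l
                        ≋ K ⊠ Mcoeff A B C (move e x) l
      by-step x K = guardedSum-⊠ (endsAtZero (move e x)) (w A B C (move e x)) K l

    -- U (+ m) l is u (m + 1) l: the weighted standard walks of length l from m to 0.
    U : ℤ → ℕ → Mat s
    U p = guardedSum (isStandard p) (w* A B C D p)

    U-zero : ∀ m → U (+ m) 0 ≋ (if isZero (+ m) then 1M else 0M)
    U-zero zero i j = +-identityʳ _
    U-zero (suc m) i j = +-identityʳ _

    U-suc : ∀ m l → U (+ m) (suc l) ≋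
      A ⊠ U (move (+ m) dn) l ⊞ (if isZero (+ m) then D else B) ⊠ U (+ m) l ⊞ C ⊠ U (move (+ m) up) l
    U-suc m l = ≋-trans (guardedSum-suc (isStandard (+ m)) (w* A B C D (+ m)) l)
      (⊞-cong (⊞-cong (by-step dn A) (by-step st (if isZero (+ m) then D else B))) (by-step up C))
      where
      by-step : ∀ x K → guardedSum (isStandard (move (+ m) x)) (λ xs → K *M w* A B C D (move (+ m) x) xs) l
                        ≋ K ⊠ U (move (+ m) x) l
      by-step x K = guardedSum-⊠ (isStandard (move (+ m) x)) (w* A B C D (move (+ m) x)) K l

    U-negative : ∀ n l → U -[1+ n ] l ≋ 𝟘
    U-negative n l = guardedSum-false (isStandard -[1+ n ]) (w* A B C D -[1+ n ]) l
      (λ xs → P.trans (P.cong (endsAtZero -[1+ n ] xs ∧_) (negative-fails xs)) (∧-zeroʳ _))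
      where
      negative-fails : ∀ xs → allNonNeg -[1+ n ] xs ≡ false
      negative-fails [] = P.refl
      negative-fails (_ ∷ _) = P.refl

module Contraction {c ℓ : Level} (𝔽 : Field c ℓ) {s : ℕ} where
  open Field 𝔽 hiding (zero)
  open WithField 𝔽 using (Series; zS)
  open PowerSeries 𝔽
  open Matrices seriesRing using (Mx; sum; _⊞_; _⊠_; _⊙_; _≋_)

  Agree : ℕ → Mx s → Mx s → Set ℓ
  Agree n X Y = ∀ i j → AgreeBelow n (X i j) (Y i j)

  Local : (Mx s → Mx s) → Set (c ⊔ ℓ)
  Local Ψ = ∀ n X Y → Agree n X Y → Agree n (Ψ X) (Ψ Y)

  Contractive : (Mx s → Mx s) → Set (c ⊔ ℓ)
  Contractive Φ = ∀ n X Y → Agree n X Y → Agree (suc n) (Φ X) (Φ Y)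

  sum-agree : ∀ {t} n (f g : Fin t → Series) → (∀ k → AgreeBelow n (f k) (g k)) → AgreeBelow n (sum f) (sum g)
  sum-agree {zero} n f g f≈g m m<n = refl
  sum-agree {suc t} n f g f≈g m m<n =
    +-cong (f≈g Fin.zero m m<n) (sum-agree n (f ∘ Fin.suc) (g ∘ Fin.suc) (f≈g ∘ Fin.suc) m m<n)

  local-const : ∀ K → Local (λ _ → K)
  local-const K n X Y _ i j m _ = refl

  local-id : Local (λ X → X)
  local-id n X Y X≈Y = X≈Y

  local-⊞ : ∀ {Ψ₁ Ψ₂} → Local Ψ₁ → Local Ψ₂ → Local (λ X → Ψ₁ X ⊞ Ψ₂ X)
  local-⊞ l₁ l₂ n X Y X≈Y i j m m<n = +-cong (l₁ n X Y X≈Y i j m m<n) (l₂ n X Y X≈Y i j m m<n)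

  local-⊠ : ∀ {Ψ₁ Ψ₂} → Local Ψ₁ → Local Ψ₂ → Local (λ X → Ψ₁ X ⊠ Ψ₂ X)
  local-⊠ {Ψ₁} {Ψ₂} l₁ l₂ n X Y X≈Y i j = sum-agree n _ _ (λ k →
    *S-agree n {Ψ₁ X i k} {Ψ₁ Y i k} {Ψ₂ X k j} {Ψ₂ Y k j} (l₁ n X Y X≈Y i k) (l₂ n X Y X≈Y k j))

  z-contractive : ∀ {Ψ} → Local Ψ → Contractive (λ X → zS ⊙ Ψ X)
  z-contractive {Ψ} l n X Y X≈Y i j zero _ = trans (zS-*S-zero (Ψ X i j)) (sym (zS-*S-zero (Ψ Y i j)))
  z-contractive {Ψ} l n X Y X≈Y i j (suc m) (s≤s m<n) =
    trans (zS-*S-suc (Ψ X i j) m) (trans (l n X Y X≈Y i j m m<n) (sym (zS-*S-suc (Ψ Y i j) m)))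

  contractive-⊞ˡ : ∀ K {Φ} → Contractive Φ → Contractive (λ X → K ⊞ Φ X)
  contractive-⊞ˡ K {Φ} contr n X Y X≈Y i j m m<n = +-congˡ (contr n X Y X≈Y i j m m<n)

  -- The fixed point is the diagonal of the Picard iteration: its n-th coefficient is stable from step n + 1 on.
  module FixedPoint (Φ : Mx s → Mx s) (contr : Contractive Φ) where
    iterate : ℕ → Mx s
    iterate zero i j n = 0#
    iterate (suc k) = Φ (iterate k)

    fix : Mx s
    fix i j n = iterate (suc n) i j n

    iterate-step : ∀ k → Agree k (iterate k) (iterate (suc k))
    iterate-step zero i j m ()
    iterate-step (suc k) = contr k _ _ (iterate-step k)

    iterate-stable : ∀ k d → Agree k (iterate k) (iterate (d ℕ.+ k))
    iterate-stable k zero i j m _ = refl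
    iterate-stable k (suc d) i j m m<k = trans (iterate-stable k d i j m m<k)
      (iterate-step (d ℕ.+ k) i j m (ℕ.<-≤-trans m<k (ℕ.m≤n+m k d)))

    fix-agree : ∀ n → Agree n fix (iterate n)
    fix-agree n i j m m<n = trans (iterate-stable (suc m) (n ∸ suc m) i j m ℕ.≤-refl)
      (reflexive (P.cong (λ k → iterate k i j m) (ℕ.m∸n+n≡m m<n)))

    fix-eq : fix ≋ Φ fix
    fix-eq i j n = sym (contr n fix (iterate n) (fix-agree n) i j n ℕ.≤-refl)

module FirstStepSystems {c ℓ : Level} (𝔽 : Field c ℓ) {s : ℕ} where
  open Field 𝔽 hiding (zero)
  open WithField 𝔽 hiding (Mat)
  open PowerSeries 𝔽
  open Matrices seriesRing
  private module Fᴹ = Matrices commutativeRing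
  open import Relation.Binary.Reasoning.Setoid (Fᴹ.≋-setoid {s})

  constM : Fᴹ.Mx s → Mx s
  constM K i j = constS (K i j)

  coeff : ℕ → Mx s → Fᴹ.Mx s
  coeff l X i j = X i j l

  indicator : Bool → Mx s
  indicator b = if b then 𝟙 else 𝟘

  coeff-constM-⊠ : ∀ K Y l → coeff l (constM K ⊠ Y) Fᴹ.≋ K Fᴹ.⊠ coeff l Y
  coeff-constM-⊠ K Y l i j = trans (sum-coeff (λ k → constS (K i k) *S Y k j) l)
    (Fᴹ.sum-cong-≋ {s} (λ k → *S-constˡ (K i k) (Y k j) l))

  coeff-indicator-zero : ∀ b → coeff 0 (indicator b) Fᴹ.≋ (if b then 1M else 0M)
  coeff-indicator-zero false i j = refl
  coeff-indicator-zero true i j with ⌊ i Fin≟ j ⌋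
  ... | true = refl
  ... | false = refl

  coeff-indicator-suc : ∀ b l → coeff (suc l) (indicator b) Fᴹ.≋ Fᴹ.𝟘
  coeff-indicator-suc false l i j = refl
  coeff-indicator-suc true l i j with ⌊ i Fin≟ j ⌋
  ... | true = refl
  ... | false = refl

  coeff-z-zero : ∀ b P → coeff 0 (indicator b ⊞ zS ⊙ P) Fᴹ.≋ (if b then 1M else 0M)
  coeff-z-zero b P i j = trans (+-cong (coeff-indicator-zero b i j) (zS-*S-zero (P i j))) (+-identityʳ _)

  coeff-z-suc : ∀ b P l → coeff (suc l) (indicator b ⊞ zS ⊙ P) Fᴹ.≋ coeff l P
  coeff-z-suc b P l i j = trans (+-cong (coeff-indicator-suc b l i j) (zS-*S-suc (P i j) l)) (+-identityˡ _)

  module _ (K : ℤ → Step → Fᴹ.Mx s) where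

    stepSum : (ℤ → Fᴹ.Mx s) → ℤ → Fᴹ.Mx s
    stepSum c e = K e dn Fᴹ.⊠ c (move e dn) Fᴹ.⊞ K e st Fᴹ.⊠ c e Fᴹ.⊞ K e up Fᴹ.⊠ c (move e up)

    stepSumS : (ℤ → Mx s) → ℤ → Mx s
    stepSumS Y e = constM (K e dn) ⊠ Y (move e dn) ⊞ constM (K e st) ⊠ Y e ⊞ constM (K e up) ⊠ Y (move e up)

    IsSeriesSolution : (ℤ → Mx s) → Set ℓ
    IsSeriesSolution Y = ∀ e → Y e ≋ indicator (isZero e) ⊞ zS ⊙ stepSumS Y e

    coeff-stepSumS : ∀ Y l e → coeff l (stepSumS Y e) Fᴹ.≋ stepSum (λ e′ → coeff l (Y e′)) e
    coeff-stepSumS Y l e i j = +-cong (+-cong (coeff-constM-⊠ (K e dn) (Y (move e dn)) l i j)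
      (coeff-constM-⊠ (K e st) (Y e) l i j)) (coeff-constM-⊠ (K e up) (Y (move e up)) l i j)

    -- Uniqueness: thanks to the factor z, coefficient l + 1 of a solution is determined by coefficient l.
    series-solution-coeff : (c : ℤ → ℕ → Fᴹ.Mx s) →
      (∀ e → c e 0 Fᴹ.≋ (if isZero e then 1M else 0M)) →
      (∀ e l → c e (suc l) Fᴹ.≋ stepSum (λ e′ → c e′ l) e) →
      ∀ Y → IsSeriesSolution Y → ∀ l e → c e l Fᴹ.≋ coeff l (Y e)
    series-solution-coeff c c-zero c-suc Y Y-sol zero e =
      Fᴹ.≋-trans (c-zero e)
        (Fᴹ.≋-sym (Fᴹ.≋-trans (λ i j → Y-sol e i j 0) (coeff-z-zero (isZero e) (stepSumS Y e))))
    series-solution-coeff c c-zero c-suc Y Y-sol (suc l) e = begin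
      c e (suc l) ≈⟨ c-suc e l ⟩
      stepSum (λ e′ → c e′ l) e
        ≈⟨ Fᴹ.⊞-cong (Fᴹ.⊞-cong (Fᴹ.⊠-cong Fᴹ.≋-refl (IH (move e dn))) (Fᴹ.⊠-cong Fᴹ.≋-refl (IH e)))
                     (Fᴹ.⊠-cong Fᴹ.≋-refl (IH (move e up))) ⟩
      stepSum (λ e′ → coeff l (Y e′)) e ≈⟨ Fᴹ.≋-sym (coeff-stepSumS Y l e) ⟩
      coeff l (stepSumS Y e) ≈⟨ Fᴹ.≋-sym (coeff-z-suc (isZero e) (stepSumS Y e) l) ⟩
      coeff (suc l) (indicator (isZero e) ⊞ zS ⊙ stepSumS Y e) ≈⟨ (λ i j → sym (Y-sol e i j (suc l))) ⟩
      coeff (suc l) (Y e) ∎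
      where
      IH : ∀ e → c e l Fᴹ.≋ coeff l (Y e)
      IH = series-solution-coeff c c-zero c-suc Y Y-sol l

module WalkGeneratingFunctions {c ℓ : Level} (𝔽 : Field c ℓ) {s : ℕ} (A B C D : WithField.Mat 𝔽 s) where
  open Field 𝔽 hiding (zero)
  open WithField 𝔽 hiding (Mat)
  open PowerSeries 𝔽
  open Matrices seriesRing
  private module Fᴹ = Matrices commutativeRing
  private module S = CommutativeRing seriesRing
  open Walks 𝔽 {s} using (U; U-zero; U-suc; U-negative; Mcoeff-zero; Mcoeff-suc)
  open Contraction 𝔽 {s}
  open FirstStepSystems 𝔽 {s}
  open import Relation.Binary.Reasoning.Setoid (≋-setoid {s})

  A′ B′ C′ D′ : Mx s
  A′ = constM A
  B′ = constM B
  C′ = constM C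
  D′ = constM D

  walkWeight : ℤ → Step → Fᴹ.Mx s
  walkWeight _ dn = A
  walkWeight _ st = B
  walkWeight _ up = C

  -- Standard walks never visit negative positions, so from there every step gets weight 0.
  standardWeight : ℤ → Step → Fᴹ.Mx s
  standardWeight (+ m) dn = A
  standardWeight (+ m) st = if isZero (+ m) then D else B
  standardWeight (+ m) up = C
  standardWeight -[1+ _ ] _ = 0M

  quadratic-contractive : ∀ a b c → Contractive (λ X → zS ⊙ (a ⊞ b ⊠ X ⊞ c ⊠ X ⊠ X))
  quadratic-contractive a b c = z-contractive
    (local-⊞ (local-⊞ (local-const a) (local-⊠ (local-const b) local-id))
             (local-⊠ (local-⊠ (local-const c) local-id) local-id))

  linear-contractive : ∀ P → Contractive (λ X → 𝟙 ⊞ zS ⊙ (P ⊠ X))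
  linear-contractive P = contractive-⊞ˡ 𝟙 (z-contractive (local-⊠ (local-const P) local-id))

  -- F and G are the first-passage series, M₀ = (1 - z (A G + B + C F))⁻¹ and W = (1 - z (D + C F))⁻¹;
  -- H and H⁺ are the closed forms of the M_e and of the series of the u_{m+1}.
  module FirstPassageDown =
    FixedPoint (λ X → zS ⊙ (A′ ⊞ B′ ⊠ X ⊞ C′ ⊠ X ⊠ X)) (quadratic-contractive A′ B′ C′)
  module FirstPassageUp =
    FixedPoint (λ X → zS ⊙ (C′ ⊞ B′ ⊠ X ⊞ A′ ⊠ X ⊠ X)) (quadratic-contractive C′ B′ A′)

  F G : Mx s
  F = FirstPassageDown.fix
  G = FirstPassageUp.fix

  module Return =
    FixedPoint (λ X → 𝟙 ⊞ zS ⊙ ((A′ ⊠ G ⊞ B′ ⊞ C′ ⊠ F) ⊠ X))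
               (linear-contractive (A′ ⊠ G ⊞ B′ ⊞ C′ ⊠ F))
  module StandardReturn =
    FixedPoint (λ X → 𝟙 ⊞ zS ⊙ ((D′ ⊞ C′ ⊠ F) ⊠ X)) (linear-contractive (D′ ⊞ C′ ⊠ F))

  M₀ W : Mx s
  M₀ = Return.fix
  W = StandardReturn.fix

  H : ℤ → Mx s
  H (+ n) = F ^[ n ] M₀
  H -[1+ n ] = G ^[ suc n ] M₀

  H⁺ : ℤ → Mx s
  H⁺ (+ m) = F ^[ m ] W
  H⁺ -[1+ _ ] = 𝟘

  H-solution : IsSeriesSolution walkWeight H
  H-solution (+ zero) = ≋-trans Return.fix-eq (⊞-cong ≋-refl (⊙-congˡ zS (begin
    (A′ ⊠ G ⊞ B′ ⊞ C′ ⊠ F) ⊠ M₀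
      ≈⟨ ≋-trans (⊠-distribʳ M₀ _ _) (⊞-cong (⊠-distribʳ M₀ _ _) ≋-refl) ⟩
    A′ ⊠ G ⊠ M₀ ⊞ B′ ⊠ M₀ ⊞ C′ ⊠ F ⊠ M₀
      ≈⟨ ⊞-cong (⊞-cong (⊠-assoc A′ G M₀) ≋-refl) (⊠-assoc C′ F M₀) ⟩
    A′ ⊠ (G ⊠ M₀) ⊞ B′ ⊠ M₀ ⊞ C′ ⊠ (F ⊠ M₀) ∎)))
  H-solution (+ suc n) = begin
    F ⊠ (F ^[ n ] M₀)
      ≈⟨ ⊠-quadratic zS A′ B′ C′ F FirstPassageDown.fix-eq (F ^[ n ] M₀) ⟩
    zS ⊙ (A′ ⊠ H (+ n) ⊞ B′ ⊠ H (+ suc n) ⊞ C′ ⊠ H (+ suc (suc n)))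
      ≈⟨ ≋-sym (⊞-identityˡ _) ⟩
    𝟘 ⊞ zS ⊙ (A′ ⊠ H (+ n) ⊞ B′ ⊠ H (+ suc n) ⊞ C′ ⊠ H (+ suc (suc n)))
      ≡⟨ P.cong (λ e → 𝟘 ⊞ zS ⊙ (A′ ⊠ H (+ n) ⊞ B′ ⊠ H (+ suc n) ⊞ C′ ⊠ H e))
                (P.cong +_ (ℕ.+-comm (suc n) 1)) ⟨
    𝟘 ⊞ zS ⊙ (A′ ⊠ H (+ n) ⊞ B′ ⊠ H (+ suc n) ⊞ C′ ⊠ H (move (+ suc n) up)) ∎
  H-solution -[1+ n ] = begin
    G ⊠ (G ^[ n ] M₀)
      ≈⟨ ⊠-quadratic zS C′ B′ A′ G FirstPassageUp.fix-eq (G ^[ n ] M₀) ⟩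
    zS ⊙ (C′ ⊠ (G ^[ n ] M₀) ⊞ B′ ⊠ H -[1+ n ] ⊞ A′ ⊠ H -[1+ suc n ])
      ≈⟨ ≋-trans (⊙-congˡ zS (⊞-reverse _ _ _)) (≋-sym (⊞-identityˡ _)) ⟩
    𝟘 ⊞ zS ⊙ (A′ ⊠ H -[1+ suc n ] ⊞ B′ ⊠ H -[1+ n ] ⊞ C′ ⊠ (G ^[ n ] M₀))
      ≡⟨ P.cong₂ (λ e X → 𝟘 ⊞ zS ⊙ (A′ ⊠ H e ⊞ B′ ⊠ H -[1+ n ] ⊞ C′ ⊠ X))
                 (P.cong -[1+_] (P.cong suc (ℕ.+-identityʳ n))) (H-up n) ⟨
    𝟘 ⊞ zS ⊙ (A′ ⊠ H (move -[1+ n ] dn) ⊞ B′ ⊠ H -[1+ n ] ⊞ C′ ⊠ H (move -[1+ n ] up)) ∎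
    where
    H-up : ∀ n → H (move -[1+ n ] up) ≡ G ^[ n ] M₀
    H-up zero = P.refl
    H-up (suc n) = P.refl

  H⁺-solution : IsSeriesSolution standardWeight H⁺
  H⁺-solution (+ zero) = ≋-trans StandardReturn.fix-eq (⊞-cong ≋-refl (⊙-congˡ zS (begin
    (D′ ⊞ C′ ⊠ F) ⊠ W                  ≈⟨ ⊠-distribʳ W _ _ ⟩
    D′ ⊠ W ⊞ C′ ⊠ F ⊠ W                ≈⟨ ⊞-cong (≋-sym (⊞-identityˡ _)) (⊠-assoc C′ F W) ⟩
    𝟘 ⊞ D′ ⊠ W ⊞ C′ ⊠ (F ⊠ W)          ≈⟨ ⊞-cong (⊞-cong (≋-sym (⊠-zeroʳ A′)) ≋-refl) ≋-refl ⟩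
    A′ ⊠ 𝟘 ⊞ D′ ⊠ W ⊞ C′ ⊠ (F ⊠ W) ∎)))
  H⁺-solution (+ suc n) = begin
    F ⊠ (F ^[ n ] W)
      ≈⟨ ⊠-quadratic zS A′ B′ C′ F FirstPassageDown.fix-eq (F ^[ n ] W) ⟩
    zS ⊙ (A′ ⊠ H⁺ (+ n) ⊞ B′ ⊠ H⁺ (+ suc n) ⊞ C′ ⊠ H⁺ (+ suc (suc n)))
      ≈⟨ ≋-sym (⊞-identityˡ _) ⟩
    𝟘 ⊞ zS ⊙ (A′ ⊠ H⁺ (+ n) ⊞ B′ ⊠ H⁺ (+ suc n) ⊞ C′ ⊠ H⁺ (+ suc (suc n)))
      ≡⟨ P.cong (λ e → 𝟘 ⊞ zS ⊙ (A′ ⊠ H⁺ (+ n) ⊞ B′ ⊠ H⁺ (+ suc n) ⊞ C′ ⊠ H⁺ e))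
                (P.cong +_ (ℕ.+-comm (suc n) 1)) ⟨
    𝟘 ⊞ zS ⊙ (A′ ⊠ H⁺ (+ n) ⊞ B′ ⊠ H⁺ (+ suc n) ⊞ C′ ⊠ H⁺ (move (+ suc n) up)) ∎
  H⁺-solution -[1+ n ] = ≋-sym (begin
    𝟘 ⊞ zS ⊙ (O ⊠ H⁺ (move -[1+ n ] dn) ⊞ O ⊠ 𝟘 ⊞ O ⊠ H⁺ (move -[1+ n ] up))
      ≈⟨ ⊞-cong ≋-refl (⊙-congˡ zS (⊞-cong (⊞-cong (O⊠≋𝟘 _) (O⊠≋𝟘 𝟘)) (O⊠≋𝟘 _))) ⟩
    𝟘 ⊞ zS ⊙ (𝟘 ⊞ 𝟘 ⊞ 𝟘)
      ≈⟨ (λ i j → S.trans (S.+-identityˡ _)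
                    (S.trans (S.*-congˡ (S.trans (S.+-identityʳ _) (S.+-identityʳ _))) (S.zeroʳ zS))) ⟩
    𝟘 ∎)
    where
    O : Mx s
    O = constM 0M
    O⊠≋𝟘 : ∀ X → O ⊠ X ≋ 𝟘
    O⊠≋𝟘 X = ≋-trans (⊠-cong (λ i j → λ { zero → refl ; (suc _) → refl }) ≋-refl) (⊠-zeroˡ X)

  walkSeries : ℤ → Mx s
  walkSeries e i j l = Mcoeff A B C e l i j

  walkSeries≋H : ∀ e → walkSeries e ≋ H e
  walkSeries≋H e i j l = series-solution-coeff walkWeight (Mcoeff A B C) (Mcoeff-zero A B C D) (Mcoeff-suc A B C D)
    H H-solution l e i j

  standardSeries : ℕ → Mx s
  standardSeries m i j l = u A B C D (suc m) l i j

  standardSeries≋F^W : ∀ m → standardSeries m ≋ F ^[ m ] W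
  standardSeries≋F^W m i j l =
    series-solution-coeff standardWeight (U A B C D) U-zero′ U-suc′ H⁺ H⁺-solution l (+ m) i j
    where
    U-zero′ : ∀ p → U A B C D p 0 Fᴹ.≋ (if isZero p then 1M else 0M)
    U-zero′ (+ m) = U-zero A B C D m
    U-zero′ -[1+ n ] = U-negative A B C D n 0
    U-suc′ : ∀ p l → U A B C D p (suc l) Fᴹ.≋ stepSum standardWeight (λ p′ → U A B C D p′ l) p
    U-suc′ (+ m) l = U-suc A B C D m l
    U-suc′ -[1+ n ] l = Fᴹ.≋-trans (U-negative A B C D n (suc l)) (Fᴹ.≋-sym (λ i j →
      trans (+-cong (+-cong (Fᴹ.⊠-zeroˡ (U′ (move -[1+ n ] dn)) i j) (Fᴹ.⊠-zeroˡ (U′ -[1+ n ]) i j))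
                   (Fᴹ.⊠-zeroˡ (U′ (move -[1+ n ] up)) i j))
            (trans (+-identityʳ _) (+-identityʳ _))))
      where
      U′ : ℤ → Fᴹ.Mx s
      U′ p = U A B C D p l

module Localisation {c ℓ : Level} (𝔽 : Field c ℓ) {s : ℕ} (A B C : WithField.Mat 𝔽 s) where
  open Field 𝔽 hiding (zero)
  open WithField 𝔽 hiding (Mat)
  open PowerSeries 𝔽
  private module S = CommutativeRing seriesRing
  open Matrices seriesRing using (sum; Mx; _≋_; _⊞_; _⊟_; _⊠_; _⊙_; 𝟙; _^[_]_)
  private module Fᴹ = Matrices commutativeRing
  open SubtractionLemmas seriesRing
  open import Algebra.Solver.Ring.NaturalCoefficients.Default S.commutativeSemiring using (solve; _:+_; _:*_; _:=_)
  open import Relation.Binary.Reasoning.Setoid S.setoid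

  -- Quotients p / q of ring elements whose denominator has constant term 1: a subring of 𝓛, closed under
  -- division by its elements with constant term 1.
  ℒ : Series → Set (c ⊔ ℓ)
  ℒ f = ∃ λ p → ∃ λ q → InRing A B C p × InRing A B C q × q 0 ≈ 1# × (f *S q) ≃S p

  ℒ⇒InL : ∀ {f} → ℒ f → InL A B C f
  ℒ⇒InL (p , q , p∈ , q∈ , q₀≈1 , fq≃p) =
    p , q , p∈ , q∈ , (λ q≃0 → 1≉0 (trans (sym q₀≈1) (q≃0 0))) , fq≃p

  ℒ-resp : ∀ {f g} → f ≃S g → ℒ f → ℒ g
  ℒ-resp f≃g (p , q , p∈ , q∈ , q₀≈1 , fq≃p) =
    p , q , p∈ , q∈ , q₀≈1 , S.trans (S.*-congʳ (S.sym f≃g)) fq≃p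

  ℒ-ring : ∀ {p} → InRing A B C p → ℒ p
  ℒ-ring {p} p∈ = p , 1S , p∈ , const 1# , refl , S.*-identityʳ p

  ℒ-const : ∀ x → ℒ (constS x)
  ℒ-const x = ℒ-ring (const x)

  ℒ-0 : ℒ 0S
  ℒ-0 = ℒ-resp (λ { zero → refl ; (suc _) → refl }) (ℒ-const 0#)

  ℒ-z : ℒ zS
  ℒ-z = ℒ-ring var-z

  ℒ-+ : ∀ {f g} → ℒ f → ℒ g → ℒ (f +S g)
  ℒ-+ {f} {g} (p₁ , q₁ , p₁∈ , q₁∈ , q₁₀ , fq₁≃p₁)
              (p₂ , q₂ , p₂∈ , q₂∈ , q₂₀ , gq₂≃p₂) =
    (p₁ *S q₂) +S (p₂ *S q₁) , q₁ *S q₂ , add (mul p₁∈ q₂∈) (mul p₂∈ q₁∈) , mul q₁∈ q₂∈ ,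
    trans (*S-at-zero q₁ q₂) (trans (*-cong q₁₀ q₂₀) (*-identityˡ 1#)) ,
    (begin
      (f +S g) *S (q₁ *S q₂)
        ≈⟨ solve 4 (λ f g q₁ q₂ → (f :+ g) :* (q₁ :* q₂) := f :* q₁ :* q₂ :+ g :* q₂ :* q₁) S.refl f g q₁ q₂ ⟩
      ((f *S q₁) *S q₂) +S ((g *S q₂) *S q₁) ≈⟨ S.+-cong (S.*-congʳ fq₁≃p₁) (S.*-congʳ gq₂≃p₂) ⟩
      (p₁ *S q₂) +S (p₂ *S q₁)                ∎)

  ℒ-* : ∀ {f g} → ℒ f → ℒ g → ℒ (f *S g)
  ℒ-* {f} {g} (p₁ , q₁ , p₁∈ , q₁∈ , q₁₀ , fq₁≃p₁)
              (p₂ , q₂ , p₂∈ , q₂∈ , q₂₀ , gq₂≃p₂) =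
    p₁ *S p₂ , q₁ *S q₂ , mul p₁∈ p₂∈ , mul q₁∈ q₂∈ ,
    trans (*S-at-zero q₁ q₂) (trans (*-cong q₁₀ q₂₀) (*-identityˡ 1#)) ,
    (begin
      (f *S g) *S (q₁ *S q₂)
        ≈⟨ solve 4 (λ f g q₁ q₂ → (f :* g) :* (q₁ :* q₂) := (f :* q₁) :* (g :* q₂)) S.refl f g q₁ q₂ ⟩
      (f *S q₁) *S (g *S q₂)   ≈⟨ S.*-cong fq₁≃p₁ gq₂≃p₂ ⟩
      p₁ *S p₂                 ∎)

  ℒ-neg : ∀ {f} → ℒ f → ℒ (-S f)
  ℒ-neg {f} f∈ = ℒ-resp (λ n → trans (*S-constˡ (- 1#) f n) (-1*x≈-x (f n))) (ℒ-* (ℒ-const (- 1#)) f∈)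
    where open import Algebra.Properties.Ring ring using (-1*x≈-x)

  ℒ-sub : ∀ {f g} → ℒ f → ℒ g → ℒ (f S.- g)
  ℒ-sub f∈ g∈ = ℒ-+ f∈ (ℒ-neg g∈)

  ℒ-sum : ∀ {t} (f : Fin t → Series) → (∀ k → ℒ (f k)) → ℒ (sum f)
  ℒ-sum {zero} f f∈ = ℒ-0
  ℒ-sum {suc t} f f∈ = ℒ-+ (f∈ Fin.zero) (ℒ-sum (f ∘ Fin.suc) (f∈ ∘ Fin.suc))

  ℒ-div : ∀ {f g} → ℒ (f *S g) → ℒ g → g 0 ≈ 1# → ℒ f
  ℒ-div {f} {g} (p₁ , q₁ , p₁∈ , q₁∈ , q₁₀ , fgq₁≃p₁)
                (p₂ , q₂ , p₂∈ , q₂∈ , q₂₀ , gq₂≃p₂) g₀ =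
    p₁ *S q₂ , q₁ *S p₂ , mul p₁∈ q₂∈ , mul q₁∈ p₂∈ ,
    trans (*S-at-zero q₁ p₂) (trans (*-cong q₁₀ p₂₀) (*-identityˡ 1#)) ,
    (begin
      f *S (q₁ *S p₂)          ≈⟨ S.*-congˡ (S.*-congˡ (S.sym gq₂≃p₂)) ⟩
      f *S (q₁ *S (g *S q₂))
        ≈⟨ solve 4 (λ f g q₁ q₂ → f :* (q₁ :* (g :* q₂)) := (f :* g) :* q₁ :* q₂) S.refl f g q₁ q₂ ⟩
      ((f *S g) *S q₁) *S q₂   ≈⟨ S.*-congʳ fgq₁≃p₁ ⟩
      p₁ *S q₂                 ∎)
    where
    p₂₀ : p₂ 0 ≈ 1#
    p₂₀ = trans (sym (gq₂≃p₂ 0)) (trans (*S-at-zero g q₂) (trans (*-cong g₀ q₂₀) (*-identityˡ 1#)))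

  -- Fraction-free Gaussian elimination: the pivot has constant term 1, so it is divided out only once, at the end.
  ℒ-solve : ∀ {t r} (K : Fin t → Fin t → Series) (Y V : Fin t → Fin r → Series) →
    (∀ i k → K i k 0 ≈ Fᴹ.δ i k) → (∀ i k → ℒ (K i k)) → (∀ i j → ℒ (V i j)) →
    (∀ i j → sum (λ k → K i k *S Y k j) ≃S V i j) → ∀ i j → ℒ (Y i j)
  ℒ-solve {zero} K Y V K₀ K∈ V∈ KY≃V ()
  ℒ-solve {suc t} K Y V K₀ K∈ V∈ KY≃V = solution
    where
    a : Series
    a = K Fin.zero Fin.zero
    row col : Fin t → Series
    row k = K Fin.zero (Fin.suc k)
    col i = K (Fin.suc i) Fin.zero
    K′ : Fin t → Fin t → Series
    K′ i k = a S.* K (Fin.suc i) (Fin.suc k) S.- col i S.* row k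
    Y′ V′ : Fin t → Fin _ → Series
    Y′ i j = Y (Fin.suc i) j
    V′ i j = a S.* V (Fin.suc i) j S.- col i S.* V Fin.zero j

    K′Y′≃V′ : ∀ i j → sum (λ k → K′ i k *S Y′ k j) ≃S V′ i j
    K′Y′≃V′ i j = begin
      sum (λ k → K′ i k *S Y′ k j)
        ≈⟨ Matrices.sum-combination seriesRing a (col i) (λ k → K (Fin.suc i) (Fin.suc k)) row (λ k → Y′ k j) ⟩
      a S.* U S.- col i S.* T
        ≈⟨ S.sym (cross-elimination a (col i) (Y Fin.zero j) U T) ⟩
      a S.* (col i S.* Y Fin.zero j S.+ U) S.- col i S.* (a S.* Y Fin.zero j S.+ T)
        ≈⟨ S.+-cong (S.*-congˡ (KY≃V (Fin.suc i) j)) (S.-‿cong (S.*-congˡ (KY≃V Fin.zero j))) ⟩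
      V′ i j ∎
      where
      U T : Series
      U = sum (λ k → K (Fin.suc i) (Fin.suc k) *S Y′ k j)
      T = sum (λ k → row k *S Y′ k j)

    K′₀ : ∀ i k → K′ i k 0 ≈ Fᴹ.δ i k
    K′₀ i k = R.begin
      (a *S K (Fin.suc i) (Fin.suc k)) 0 + - (col i *S row k) 0
        R.≈⟨ +-cong (*S-at-zero a (K (Fin.suc i) (Fin.suc k))) (-‿cong (*S-at-zero (col i) (row k))) ⟩
      a 0 * K (Fin.suc i) (Fin.suc k) 0 + - (col i 0 * row k 0)
        R.≈⟨ +-cong (*-cong (K₀ Fin.zero Fin.zero) (K₀ (Fin.suc i) (Fin.suc k)))
                    (-‿cong (*-congʳ (K₀ (Fin.suc i) Fin.zero))) ⟩
      1# * Fᴹ.δ (Fin.suc i) (Fin.suc k) + - (0# * row k 0)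
        R.≈⟨ +-cong (trans (*-identityˡ _) (reflexive (Fᴹ.δ-suc i k))) (trans (-‿cong (zeroˡ _)) -0#≈0#) ⟩
      Fᴹ.δ i k + 0#
        R.≈⟨ +-identityʳ _ ⟩
      Fᴹ.δ i k R.∎
      where
      module R = Relation.Binary.Reasoning.Setoid setoid
      open import Algebra.Properties.Ring ring using (-0#≈0#)

    Y′∈ : ∀ i j → ℒ (Y′ i j)
    Y′∈ = ℒ-solve K′ Y′ V′ K′₀
      (λ i k → ℒ-sub (ℒ-* (K∈ Fin.zero Fin.zero) (K∈ (Fin.suc i) (Fin.suc k)))
                     (ℒ-* (K∈ (Fin.suc i) Fin.zero) (K∈ Fin.zero (Fin.suc k))))
      (λ i j → ℒ-sub (ℒ-* (K∈ Fin.zero Fin.zero) (V∈ (Fin.suc i) j))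
                     (ℒ-* (K∈ (Fin.suc i) Fin.zero) (V∈ Fin.zero j)))
      K′Y′≃V′

    solution : ∀ i j → ℒ (Y i j)
    solution Fin.zero j =
      ℒ-div (ℒ-resp Y₀a≃ (ℒ-sub (V∈ Fin.zero j) (ℒ-sum _ (λ k → ℒ-* (K∈ Fin.zero (Fin.suc k)) (Y′∈ k j)))))
            (K∈ Fin.zero Fin.zero) (K₀ Fin.zero Fin.zero)
      where
      Y₀a≃ : (V Fin.zero j S.- sum (λ k → row k *S Y′ k j)) ≃S (Y Fin.zero j *S a)
      Y₀a≃ = S.sym (S.trans (S.*-comm _ _) (+≈⇒≈- (KY≃V Fin.zero j)))
    solution (Fin.suc i) j = Y′∈ i j

  ℒᴹ : Mx s → Set (c ⊔ ℓ)
  ℒᴹ X = ∀ i j → ℒ (X i j)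

  ℒᴹ-resp : ∀ {X Y} → X ≋ Y → ℒᴹ X → ℒᴹ Y
  ℒᴹ-resp X≋Y X∈ i j = ℒ-resp (X≋Y i j) (X∈ i j)

  ℒᴹ-⊞ : ∀ {X Y} → ℒᴹ X → ℒᴹ Y → ℒᴹ (X ⊞ Y)
  ℒᴹ-⊞ X∈ Y∈ i j = ℒ-+ (X∈ i j) (Y∈ i j)

  ℒᴹ-⊟ : ∀ {X Y} → ℒᴹ X → ℒᴹ Y → ℒᴹ (X ⊟ Y)
  ℒᴹ-⊟ X∈ Y∈ i j = ℒ-sub (X∈ i j) (Y∈ i j)

  ℒᴹ-⊠ : ∀ {X Y} → ℒᴹ X → ℒᴹ Y → ℒᴹ (X ⊠ Y)
  ℒᴹ-⊠ {X} {Y} X∈ Y∈ i j = ℒ-sum (λ k → X i k *S Y k j) (λ k → ℒ-* (X∈ i k) (Y∈ k j))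

  ℒᴹ-⊙ : ∀ {f X} → ℒ f → ℒᴹ X → ℒᴹ (f ⊙ X)
  ℒᴹ-⊙ f∈ X∈ i j = ℒ-* f∈ (X∈ i j)

  ℒᴹ-𝟙 : ℒᴹ 𝟙
  ℒᴹ-𝟙 i j with ⌊ i Fin≟ j ⌋
  ... | true = ℒ-const 1#
  ... | false = ℒ-0

  ℒᴹ-const : ∀ (K : Fᴹ.Mx s) → ℒᴹ (λ i j → constS (K i j))
  ℒᴹ-const K i j = ℒ-const (K i j)

  UnitAtZero : Mx s → Set ℓ
  UnitAtZero X = ∀ i j → X i j 0 ≈ Fᴹ.δ i j

  UnitAtZero-⊠ : ∀ {X Y} → UnitAtZero X → UnitAtZero Y → UnitAtZero (X ⊠ Y)
  UnitAtZero-⊠ {X} {Y} X₀ Y₀ i j = trans (sum-coeff (λ k → X i k *S Y k j) 0)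
    (trans (Fᴹ.sum-cong-≋ {s} (λ k → trans (*S-at-zero (X i k) (Y k j)) (*-cong (X₀ i k) (Y₀ k j))))
           (Fᴹ.⊠-identityˡ Fᴹ.𝟙 i j))

  ℒᴹ-solve : ∀ {K Y V} → UnitAtZero K → ℒᴹ K → ℒᴹ V → K ⊠ Y ≋ V → ℒᴹ Y
  ℒᴹ-solve {K} {Y} {V} = ℒ-solve K Y V

  ℒᴹ-^[] : ∀ {X} → ℒᴹ X → ∀ n {Y} → ℒᴹ Y → ℒᴹ (X ^[ n ] Y)
  ℒᴹ-^[] X∈ zero Y∈ = Y∈
  ℒᴹ-^[] X∈ (suc n) Y∈ = ℒᴹ-⊠ X∈ (ℒᴹ-^[] X∈ n Y∈)

  UnitAtZero-^[] : ∀ {X} → UnitAtZero X → ∀ n {Y} → UnitAtZero Y → UnitAtZero (X ^[ n ] Y)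
  UnitAtZero-^[] X₀ zero Y₀ = Y₀
  UnitAtZero-^[] X₀ (suc n) Y₀ = UnitAtZero-⊠ X₀ (UnitAtZero-^[] X₀ n Y₀)

module FiniteDifferences {c ℓ : Level} (𝔽 : Field c ℓ) where
  open Field 𝔽 hiding (zero)
  open WithField 𝔽
  open import Algebra.Properties.Ring ring using (-0#≈0#; -‿+-comm; -‿distribʳ-*)
  open import Algebra.Properties.CommutativeSemigroup +-commutativeSemigroup using (interchange)
  open import Algebra.Properties.Group +-group using (//-rightDividesˡ)
  open import Relation.Binary.Reasoning.Setoid setoid

  Δ : (Carrier → Carrier) → Carrier → Carrier
  Δ h x = h (1# + x) - h x

  ΔVanishes : ℕ → (Carrier → Carrier) → Set (c ⊔ ℓ)
  ΔVanishes zero h = ∀ x → h x ≈ 0#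
  ΔVanishes (suc d) h = ΔVanishes d (Δ h)

  ΔVanishes-resp : ∀ d {h g} → (∀ x → h x ≈ g x) → ΔVanishes d h → ΔVanishes d g
  ΔVanishes-resp zero h≈g h≈0 x = trans (sym (h≈g x)) (h≈0 x)
  ΔVanishes-resp (suc d) h≈g = ΔVanishes-resp d (λ x → +-cong (h≈g _) (-‿cong (h≈g x)))

  ΔVanishes-suc : ∀ d h → ΔVanishes d h → ΔVanishes (suc d) h
  ΔVanishes-suc zero h h≈0 x = trans (+-cong (h≈0 _) (-‿cong (h≈0 x))) (trans (+-identityˡ _) -0#≈0#)
  ΔVanishes-suc (suc d) h = ΔVanishes-suc d (Δ h)

  ΔVanishes-+ : ∀ d h g → ΔVanishes d h → ΔVanishes d g → ΔVanishes d (λ x → h x + g x)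
  ΔVanishes-+ zero h g h≈0 g≈0 x = trans (+-cong (h≈0 x) (g≈0 x)) (+-identityʳ _)
  ΔVanishes-+ (suc d) h g Δh Δg = ΔVanishes-resp d Δ-+ (ΔVanishes-+ d (Δ h) (Δ g) Δh Δg)
    where
    Δ-+ : ∀ x → Δ h x + Δ g x ≈ Δ (λ y → h y + g y) x
    Δ-+ x = trans (interchange _ _ _ _) (+-congˡ (-‿+-comm (h x) (g x)))

  ΔVanishes-const : ∀ d x₀ → ΔVanishes (suc d) (λ _ → x₀)
  ΔVanishes-const zero x₀ x = -‿inverseʳ x₀
  ΔVanishes-const (suc d) x₀ = ΔVanishes-suc (suc d) (λ _ → x₀) (ΔVanishes-const d x₀)

  -- h (1 + x) = h x + Δ h x, and Δ h needs one difference fewer than h.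
  ΔVanishes-shift : ∀ d h → ΔVanishes d h → ΔVanishes d (λ x → h (1# + x))
  ΔVanishes-shift zero h h≈0 x = h≈0 (1# + x)
  ΔVanishes-shift (suc d) h Δh = ΔVanishes-resp (suc d) (λ x → trans (+-comm _ _) (//-rightDividesˡ (h x) (h (1# + x))))
    (ΔVanishes-+ (suc d) h (Δ h) Δh (ΔVanishes-suc d (Δ h) Δh))

  ΔVanishes-x* : ∀ d q → ΔVanishes d q → ΔVanishes (suc d) (λ x → x * q x)
  ΔVanishes-x* zero q q≈0 x =
    trans (+-cong (trans (*-congˡ (q≈0 _)) (zeroʳ _)) (-‿cong (trans (*-congˡ (q≈0 x)) (zeroʳ _))))
          (trans (+-identityˡ _) -0#≈0#)
  ΔVanishes-x* (suc d) q Δq = ΔVanishes-resp (suc d) Δ-x*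
    (ΔVanishes-+ (suc d) (λ x → q (1# + x)) (λ x → x * Δ q x)
                 (ΔVanishes-shift (suc d) q Δq) (ΔVanishes-x* d (Δ q) Δq))
    where
    Δ-x* : ∀ x → q (1# + x) + x * Δ q x ≈ (1# + x) * q (1# + x) - x * q x
    Δ-x* x = begin
      q (1# + x) + x * (q (1# + x) - q x)          ≈⟨ +-congˡ (distribˡ x _ _) ⟩
      q (1# + x) + (x * q (1# + x) + x * - q x)    ≈⟨ sym (+-assoc _ _ _) ⟩
      (q (1# + x) + x * q (1# + x)) + x * - q x
        ≈⟨ +-cong (sym (trans (distribʳ _ _ _) (+-congʳ (*-identityˡ _)))) (sym (-‿distribʳ-* x (q x))) ⟩
      (1# + x) * q (1# + x) - x * q x              ∎

  evalPoly-ΔVanishes : ∀ cs → ΔVanishes (length cs) (evalPoly cs)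
  evalPoly-ΔVanishes [] x = refl
  evalPoly-ΔVanishes (c₀ ∷ cs) = ΔVanishes-+ (suc (length cs)) (λ _ → c₀) (λ x → x * evalPoly cs x)
    (ΔVanishes-const (length cs) c₀) (ΔVanishes-x* (length cs) (evalPoly cs) (evalPoly-ΔVanishes cs))

  Δₛ : (ℕ → Carrier) → ℕ → Carrier
  Δₛ b m = b (suc m) - b m

  ΔₛEventuallyVanishes : ℕ → (ℕ → Carrier) → Set ℓ
  ΔₛEventuallyVanishes zero b = ∃ λ N → ∀ m → N ≤ m → b m ≈ 0#
  ΔₛEventuallyVanishes (suc d) b = ΔₛEventuallyVanishes d (Δₛ b)

  sample-ΔVanishes : ∀ d h b N → ΔVanishes d h → (∀ m → N ≤ m → b m ≈ h (ι (suc m))) →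
    ΔₛEventuallyVanishes d b
  sample-ΔVanishes zero h b N h≈0 b≈h = N , λ m N≤m → trans (b≈h m N≤m) (h≈0 _)
  sample-ΔVanishes (suc d) h b N Δh b≈h = sample-ΔVanishes d (Δ h) (Δₛ b) N Δh
    (λ m N≤m → +-cong (b≈h (suc m) (ℕ.m≤n⇒m≤1+n N≤m)) (-‿cong (b≈h m N≤m)))

  EventuallyPolynomial⇒ΔₛEventuallyVanishes : ∀ a → EventuallyPolynomial a →
    ∃ λ d → ΔₛEventuallyVanishes d (a ∘ suc)
  EventuallyPolynomial⇒ΔₛEventuallyVanishes a (cs , N , a≈p) = length cs ,
    sample-ΔVanishes (length cs) (evalPoly cs) (a ∘ suc) N (evalPoly-ΔVanishes cs)
                     (λ m N≤m → a≈p (suc m) (ℕ.m≤n⇒m≤1+n N≤m))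

module EventuallyPolynomialSums {c ℓ : Level} (𝔽 : Field c ℓ) {s : ℕ} (A B C D : WithField.Mat 𝔽 s) where
  open Field 𝔽 hiding (zero)
  open WithField 𝔽 hiding (Mat)
  open PowerSeries 𝔽
  open Matrices seriesRing
  private module S = CommutativeRing seriesRing
  private module Fᴹ = Matrices commutativeRing
  open FirstStepSystems 𝔽 {s} using (coeff-indicator-zero)
  open WalkGeneratingFunctions 𝔽 A B C D
    using (F; W; M₀; A′; B′; C′; D′; walkSeries; walkSeries≋H; standardSeries≋F^W;
           module FirstPassageDown; module StandardReturn)
  open Contraction 𝔽 {s} using (Agree; local-⊠; local-const; local-id)
  open Localisation 𝔽 A B C
  open Walks 𝔽 {s} using (Mcoeff-zero)
  open FiniteDifferences 𝔽 using (Δₛ; ΔₛEventuallyVanishes)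
  open import Relation.Binary.Reasoning.Setoid (≋-setoid {s})

  M₀∈ℒ : ℒᴹ M₀
  M₀∈ℒ i j = ℒ-resp (walkSeries≋H (+ 0) i j) (ℒ-ring (entry z0 i j))

  M₀-unitAtZero : UnitAtZero M₀
  M₀-unitAtZero i j = trans (sym (walkSeries≋H (+ 0) i j 0)) (Mcoeff-zero A B C D (+ 0) i j)

  -- F M₀ = M₁ has entries in the ring, and M₀ is invertible at z = 0.
  F∈ℒ : ℒᴹ F
  F∈ℒ i j = Fᵀ∈ℒ j i
    where
    Fᵀ∈ℒ : ℒᴹ (F ᵀ)
    Fᵀ∈ℒ = ℒᴹ-solve {M₀ ᵀ} {F ᵀ} {walkSeries (+ 1) ᵀ}
      (λ i j → trans (M₀-unitAtZero j i) (reflexive (Fᴹ.δ-sym j i))) (λ i j → M₀∈ℒ j i)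
      (λ i j → ℒ-ring (entry p1 j i))
      (≋-trans (≋-sym (⊠-transpose F M₀)) (λ i j n → sym (walkSeries≋H (+ 1) j i n)))

  Pₛ : Mx s
  Pₛ = D′ ⊞ C′ ⊠ F

  W∈ℒ : ℒᴹ W
  W∈ℒ = ℒᴹ-solve {𝟙 ⊟ zS ⊙ Pₛ} {W} {𝟙} unit
    (ℒᴹ-⊟ ℒᴹ-𝟙 (ℒᴹ-⊙ ℒ-z (ℒᴹ-⊞ (ℒᴹ-const D) (ℒᴹ-⊠ (ℒᴹ-const C) F∈ℒ))))
    ℒᴹ-𝟙 solves
    where
    unit : UnitAtZero (𝟙 ⊟ zS ⊙ Pₛ)
    unit i j = trans (+-cong (coeff-indicator-zero true i j) (-‿cong (zS-*S-zero (Pₛ i j))))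
                     (trans (+-congˡ -0#≈0#) (+-identityʳ _))
      where open import Algebra.Properties.Ring ring using (-0#≈0#)
    solves : (𝟙 ⊟ zS ⊙ Pₛ) ⊠ W ≋ 𝟙
    solves = begin
      (𝟙 ⊟ zS ⊙ Pₛ) ⊠ W               ≈⟨ ⊟-distribʳ W 𝟙 (zS ⊙ Pₛ) ⟩
      𝟙 ⊠ W ⊟ zS ⊙ Pₛ ⊠ W
        ≈⟨ ⊟-cong (≋-trans (⊠-identityˡ W) StandardReturn.fix-eq) (⊙-⊠ˡ zS Pₛ W) ⟩
      𝟙 ⊞ zS ⊙ (Pₛ ⊠ W) ⊟ zS ⊙ (Pₛ ⊠ W) ≈⟨ (λ i j → //-rightDividesʳ _ _) ⟩
      𝟙                               ∎
      where open import Algebra.Properties.Group S.+-group using (//-rightDividesʳ)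

  VanishesBelowᴹ : ℕ → Mx s → Set ℓ
  VanishesBelowᴹ n X = ∀ i j → VanishesBelow n (X i j)

  ⊠-vanishes : ∀ p q {X Y} → VanishesBelowᴹ p X → VanishesBelowᴹ q Y → VanishesBelowᴹ (p ℕ.+ q) (X ⊠ Y)
  ⊠-vanishes p q {X} {Y} X≈0 Y≈0 i j n n< = trans (sum-coeff (λ k → X i k *S Y k j) n)
    (Fᴹ.sum-zero (λ k → (X i k *S Y k j) n) (λ k → *S-vanishes p q (X i k) (Y k j) (X≈0 i k) (Y≈0 k j) n n<))

  F-vanishes : VanishesBelowᴹ 1 F
  F-vanishes i j zero _ = trans (FirstPassageDown.fix-eq i j 0) (zS-*S-zero ((A′ ⊞ B′ ⊠ F ⊞ C′ ⊠ F ⊠ F) i j))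
  F-vanishes i j (suc _) (s≤s ())

  F^W-vanishes : ∀ m → VanishesBelowᴹ m (F ^[ m ] W)
  F^W-vanishes zero i j n ()
  F^W-vanishes (suc m) = ⊠-vanishes 1 m F-vanishes (F^W-vanishes m)

  ∑< : ℕ → (ℕ → Carrier) → Carrier
  ∑< n f = Fᴹ.sum (λ (m : Fin n) → f (toℕ m))

  ∑<-stable : ∀ K f → (∀ m → K ≤ m → f m ≈ 0#) → ∀ N → K ≤ N → ∑< N f ≈ ∑< K f
  ∑<-stable zero f f≈0 N _ = Fᴹ.sum-zero {N} (λ m → f (toℕ m)) (λ m → f≈0 (toℕ m) z≤n)
  ∑<-stable (suc K) f f≈0 (suc N) (s≤s K≤N) =
    +-congˡ (∑<-stable K (f ∘ suc) (λ m K≤m → f≈0 (suc m) (s≤s K≤m)) N K≤N)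

  combination : (ℕ → Carrier) → (ℕ → Mx s) → ℕ → Mx s
  combination b Y zero = 𝟘
  combination b Y (suc N) = constS (b 0) ⊙ Y 0 ⊞ combination (b ∘ suc) (Y ∘ suc) N

  coeff-combination : ∀ b Y N i j n → combination b Y N i j n ≈ ∑< N (λ m → b m * Y m i j n)
  coeff-combination b Y zero i j n = refl
  coeff-combination b Y (suc N) i j n = +-cong (*S-constˡ (b 0) (Y 0 i j) n) (coeff-combination (b ∘ suc) (Y ∘ suc) N i j n)

  ⊠-combination : ∀ K b Y N → K ⊠ combination b Y N ≋ combination b (λ m → K ⊠ Y m) N
  ⊠-combination K b Y zero = ⊠-zeroʳ K
  ⊠-combination K b Y (suc N) = ≋-trans (⊠-distribˡ K _ _)
    (⊞-cong (⊙-⊠ʳ (constS (b 0)) K (Y 0)) (⊠-combination K (b ∘ suc) (Y ∘ suc) N))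

  -- Σₘ bₘ Fᵐ W, which converges because Fᵐ W vanishes below degree m.
  weightedSum : (ℕ → Carrier) → Mx s
  weightedSum b i j n = ∑< (suc n) (λ m → b m * (F ^[ m ] W) i j n)

  weightedSum-agrees : ∀ b N → Agree N (weightedSum b) (combination b (λ m → F ^[ m ] W) N)
  weightedSum-agrees b N i j n n<N = sym (trans (coeff-combination b (λ m → F ^[ m ] W) N i j n)
    (∑<-stable (suc n) (λ m → b m * (F ^[ m ] W) i j n)
               (λ m n<m → trans (*-congˡ (F^W-vanishes m i j n n<m)) (zeroʳ _)) N n<N))

  weightedSum-rec : ∀ b → weightedSum b ≋ constS (b 0) ⊙ W ⊞ F ⊠ weightedSum (b ∘ suc)
  weightedSum-rec b i j n = R.begin
    weightedSum b i j n
      R.≈⟨ weightedSum-agrees b (suc (suc n)) i j n (ℕ.m≤n⇒m≤1+n ℕ.≤-refl) ⟩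
    (constS (b 0) ⊙ W ⊞ combination (b ∘ suc) (λ m → F ⊠ (F ^[ m ] W)) (suc n)) i j n
      R.≈⟨ +-congˡ (sym (⊠-combination F (b ∘ suc) (λ m → F ^[ m ] W) (suc n) i j n)) ⟩
    (constS (b 0) ⊙ W ⊞ F ⊠ combination (b ∘ suc) (λ m → F ^[ m ] W) (suc n)) i j n
      R.≈⟨ +-congˡ (local-⊠ (local-const F) local-id (suc n) _ _
                     (λ i j m m<n → sym (weightedSum-agrees (b ∘ suc) (suc n) i j m m<n)) i j n ℕ.≤-refl) ⟩
    (constS (b 0) ⊙ W ⊞ F ⊠ weightedSum (b ∘ suc)) i j n R.∎
    where module R = Relation.Binary.Reasoning.Setoid setoid

  weightedSum-Δₛ : ∀ b → weightedSum (Δₛ b) ≋ weightedSum (b ∘ suc) ⊟ weightedSum b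
  weightedSum-Δₛ b i j n =
    trans (Fᴹ.sum-cong-≋ {suc n} (λ m → trans (distribʳ (T (toℕ m)) (b (suc (toℕ m))) (- b (toℕ m)))
                                                      (+-congˡ (sym (-‿distribˡ-* (b (toℕ m)) (T (toℕ m)))))))
          (trans (Fᴹ.∑-distrib-+ {suc n} (λ m → b (suc (toℕ m)) * T (toℕ m)) (λ m → - (b (toℕ m) * T (toℕ m))))
                 (+-congˡ (Fᴹ.sum-neg {suc n} (λ m → b (toℕ m) * T (toℕ m)))))
    where
    open import Algebra.Properties.Ring ring using (-‿distribˡ-*)
    T : ℕ → Carrier
    T m = (F ^[ m ] W) i j n

  Q : Mx s
  Q = 𝟙 ⊟ F

  Q-unitAtZero : UnitAtZero Q
  Q-unitAtZero i j = trans (+-cong (coeff-indicator-zero true i j) (-‿cong (F-vanishes i j 0 (s≤s z≤n))))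
                     (trans (+-congˡ -0#≈0#) (+-identityʳ _))
    where open import Algebra.Properties.Ring ring using (-0#≈0#)

  Q-F-commute : ∀ Y → Q ⊠ (F ⊠ Y) ≋ F ⊠ (Q ⊠ Y)
  Q-F-commute Y = begin
    (𝟙 ⊟ F) ⊠ (F ⊠ Y)          ≈⟨ ⊟-distribʳ (F ⊠ Y) 𝟙 F ⟩
    𝟙 ⊠ (F ⊠ Y) ⊟ F ⊠ (F ⊠ Y)  ≈⟨ ⊟-cong (⊠-identityˡ (F ⊠ Y)) ≋-refl ⟩
    F ⊠ Y ⊟ F ⊠ (F ⊠ Y)        ≈⟨ ⊟-distribˡ F Y (F ⊠ Y) ⟨
    F ⊠ (Y ⊟ F ⊠ Y)            ≈⟨ ⊠-cong ≋-refl (⊟-cong (⊠-identityˡ Y) ≋-refl) ⟨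
    F ⊠ (𝟙 ⊠ Y ⊟ F ⊠ Y)        ≈⟨ ⊠-cong ≋-refl (⊟-distribʳ Y 𝟙 F) ⟨
    F ⊠ ((𝟙 ⊟ F) ⊠ Y)          ∎

  Q-weightedSum : ∀ b → Q ⊠ weightedSum b ≋ constS (b 0) ⊙ W ⊞ F ⊠ weightedSum (Δₛ b)
  Q-weightedSum b = begin
    (𝟙 ⊟ F) ⊠ weightedSum b                         ≈⟨ ⊟-distribʳ (weightedSum b) 𝟙 F ⟩
    𝟙 ⊠ weightedSum b ⊟ F ⊠ weightedSum b
      ≈⟨ ⊟-cong (≋-trans (⊠-identityˡ _) (weightedSum-rec b)) ≋-refl ⟩
    b₀W ⊞ F ⊠ weightedSum (b ∘ suc) ⊟ F ⊠ weightedSum b ≈⟨ (λ i j → S.+-assoc _ _ _) ⟩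
    b₀W ⊞ (F ⊠ weightedSum (b ∘ suc) ⊟ F ⊠ weightedSum b) ≈⟨ ⊞-cong ≋-refl (⊟-distribˡ F _ _) ⟨
    b₀W ⊞ F ⊠ (weightedSum (b ∘ suc) ⊟ weightedSum b)
      ≈⟨ ⊞-cong ≋-refl (⊠-cong ≋-refl (weightedSum-Δₛ b)) ⟨
    b₀W ⊞ F ⊠ weightedSum (Δₛ b)                    ∎
    where
    b₀W : Mx s
    b₀W = constS (b 0) ⊙ W

  Q∈ℒ : ℒᴹ Q
  Q∈ℒ = ℒᴹ-⊟ ℒᴹ-𝟙 F∈ℒ

  weightedSum-eventually-zero∈ℒ : ∀ N b → (∀ m → N ≤ m → b m ≈ 0#) → ℒᴹ (weightedSum b)
  weightedSum-eventually-zero∈ℒ zero b b≈0 i j =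
    ℒ-resp (λ n → sym (Fᴹ.sum-zero {suc n} (λ m → b (toℕ m) * (F ^[ toℕ m ] W) i j n)
                                          (λ m → trans (*-congʳ (b≈0 (toℕ m) z≤n)) (zeroˡ _)))) ℒ-0
  weightedSum-eventually-zero∈ℒ (suc N) b b≈0 = ℒᴹ-resp (≋-sym (weightedSum-rec b))
    (ℒᴹ-⊞ (ℒᴹ-⊙ (ℒ-const (b 0)) W∈ℒ)
          (ℒᴹ-⊠ F∈ℒ (weightedSum-eventually-zero∈ℒ N (b ∘ suc) (λ m N≤m → b≈0 (suc m) (s≤s N≤m)))))

  -- Each factor Q = 1 - F lowers the order of the differences Δₛ needed to reach an eventually zero sequence.
  Q^d-weightedSum∈ℒ : ∀ d b → ΔₛEventuallyVanishes d b → ℒᴹ (Q ^[ d ] weightedSum b)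
  Q^d-weightedSum∈ℒ zero b (N , b≈0) = weightedSum-eventually-zero∈ℒ N b b≈0
  Q^d-weightedSum∈ℒ (suc d) b Δb = ℒᴹ-resp (≋-sym rewritten)
    (ℒᴹ-⊞ (ℒᴹ-^[] Q∈ℒ d (ℒᴹ-⊙ (ℒ-const (b 0)) W∈ℒ))
          (ℒᴹ-⊠ F∈ℒ (Q^d-weightedSum∈ℒ d (Δₛ b) Δb)))
    where
    rewritten : Q ^[ suc d ] weightedSum b ≋ Q ^[ d ] (constS (b 0) ⊙ W) ⊞ F ⊠ (Q ^[ d ] weightedSum (Δₛ b))
    rewritten = begin
      Q ⊠ (Q ^[ d ] weightedSum b)                                ≈⟨ ^[]-commute Q Q (λ _ → ≋-refl) d _ ⟩
      Q ^[ d ] (Q ⊠ weightedSum b)                                ≈⟨ ^[]-cong Q d (Q-weightedSum b) ⟩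
      Q ^[ d ] (constS (b 0) ⊙ W ⊞ F ⊠ weightedSum (Δₛ b))        ≈⟨ ^[]-distrib Q d _ _ ⟩
      Q ^[ d ] (constS (b 0) ⊙ W) ⊞ Q ^[ d ] (F ⊠ weightedSum (Δₛ b))
        ≈⟨ ⊞-cong ≋-refl (^[]-commute Q F Q-F-commute d _) ⟨
      Q ^[ d ] (constS (b 0) ⊙ W) ⊞ F ⊠ (Q ^[ d ] weightedSum (Δₛ b)) ∎

  weightedSum∈ℒ : ∀ d b → ΔₛEventuallyVanishes d b → ℒᴹ (weightedSum b)
  weightedSum∈ℒ d b Δb = ℒᴹ-solve {Q ^[ d ] 𝟙} (UnitAtZero-^[] Q-unitAtZero d (coeff-indicator-zero true))
    (ℒᴹ-^[] Q∈ℒ d ℒᴹ-𝟙) (Q^d-weightedSum∈ℒ d b Δb)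
    (≋-trans (^[]-⊠-assoc Q d 𝟙 _) (^[]-cong Q d (⊠-identityˡ _)))

  sumM-applyUpTo : ∀ (φ : ℕ → Fᴹ.Mx s) h K i j → sumM (map φ (applyUpTo h K)) i j ≈ ∑< K (λ m → φ (h m) i j)
  sumM-applyUpTo φ h zero i j = refl
  sumM-applyUpTo φ h (suc K) i j = +-congˡ (sumM-applyUpTo φ (h ∘ suc) K i j)

  R≈weightedSum : ∀ a n i j → R A B C D a n i j ≈ weightedSum (a ∘ suc) i j n
  R≈weightedSum a n i j =
    trans (reflexive (P.cong (λ ks → sumM (map uₖ ks) i j) (map-applyUpTo (λ m → m) suc (suc n))))
          (trans (sumM-applyUpTo uₖ suc (suc n) i j)
                 (Fᴹ.sum-cong-≋ {suc n} (λ m → *-congˡ {a (suc (toℕ m))} (standardSeries≋F^W (toℕ m) i j n))))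
    where
    uₖ : ℕ → Fᴹ.Mx s
    uₖ k = a k ·M u A B C D k n

theorem5p8 : ∀ {c ℓ : Level} (F : Field c ℓ) (s : ℕ) (A B C D : WithField.Mat F s)
    (a : ℕ → Field.Carrier F) → WithField.EventuallyPolynomial F a →
    ∀ (i j : Fin s) → WithField.InL F A B C (λ n → WithField.R F A B C D a n i j)
theorem5p8 F s A B C D a a-poly i j =
  ℒ⇒InL (ℒ-resp (λ n → Field.sym F (R≈weightedSum a n i j)) (weightedSum∈ℒ d (a ∘ suc) Δᵈa-vanishes i j))
  where
  open FiniteDifferences F using (ΔₛEventuallyVanishes; EventuallyPolynomial⇒ΔₛEventuallyVanishes)
  open Localisation F A B C using (ℒ⇒InL; ℒ-resp)
  open EventuallyPolynomialSums F A B C D using (R≈weightedSum; weightedSum∈ℒ)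

  d : ℕ
  d = proj₁ (EventuallyPolynomial⇒ΔₛEventuallyVanishes a a-poly)

  Δᵈa-vanishes : ΔₛEventuallyVanishes d (a ∘ suc)
  Δᵈa-vanishes = proj₂ (EventuallyPolynomial⇒ΔₛEventuallyVanishes a a-poly)
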